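{- For each $r\in\{3, 17, 24, 31, 38, 45\}$ and every nonnegative integer $k$, $$ \mathrm{cp}_{3,1,4}(49k+r) \equiv 0 \pmod 2.$$
   Context: For integers $a,b,m\ge1$, an $(a,b,m)$-copartition is a triple of integer partitions $(\gamma,\rho,\sigma)$ such that every part of $\gamma$ is $\ge a$ and $\equiv a \pmod m$, every part of $\sigma$ is $\ge b$ and $\equiv b\pmod m$, and $\rho$ has exactly as many parts as $\sigma$, each part of $\rho$ being equal to $m$ times the number of parts of $\gamma$. Its size is the sum of all parts of $\gamma,\rho,\sigma$, and $\mathrm{cp}_{a,b,m}(n)$ denotes the number of $(a,b,m)$-copartitions of size $n$. -}

module Defs where

open import Data.Nat using (ℕ; zero; suc; _+_; _*_; _∸_; _≤ᵇ_; _≡ᵇ_)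
open import Data.Bool using (Bool; true; false; if_then_else_)
open import Data.List using (List; []; _∷_; [_]; _++_; map; concatMap; length; replicate; filterᵇ; downFrom; upTo)
open import Data.Product using (_×_; _,_)
open import Data.Nat.ListAction using (sum)

-- A partition is a nonincreasing list of positive integers (its parts).

-- go f cands r : all nonincreasing lists of total r whose parts are drawn
-- from the (descending) candidate list cands; f is fuel (r suffices when
-- all candidates are ≥ 1).
go : ℕ → List ℕ → ℕ → List (List ℕ)
go _ _ zero = [ [] ]
go zero _ (suc _) = []
go (suc f) [] (suc r) = []
go (suc f) (p ∷ ps) (suc r) =
  (if (1 ≤ᵇ p) Data.Bool.∧ (p ≤ᵇ suc r)
     then map (p ∷_) (go f (p ∷ ps) (suc r ∸ p))
     else [])
  ++ go (suc f) ps (suc r)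

progPartitions : (a m s : ℕ) → List (List ℕ)
progPartitions a m s = go s (map (λ t → a + t * m) (downFrom (suc s))) s

Copartition : Set
Copartition = List ℕ × List ℕ × List ℕ

size : Copartition → ℕ
size (γ , ρ , σ) = sum γ + sum ρ + sum σ

copartitions : (a b m n : ℕ) → List Copartition
copartitions a b m n =
  filterᵇ (λ c → size c ≡ᵇ n)
    (concatMap (λ s₁ →
      concatMap (λ γ →
        concatMap (λ s₂ →
          map (λ σ → (γ , replicate (length σ) (m * length γ) , σ))
              (progPartitions b m s₂))
          (upTo (suc n)))
        (progPartitions a m s₁))
      (upTo (suc n)))

cp : (a b m n : ℕ) → ℕ
cp a b m n = length (copartitions a b m n)

{-# OPTIONS --safe #-}
-- The generating function of (3,1,4)-copartitions is
--   Σ_ℓ q^(3ℓ) / ((q⁴;q⁴)_ℓ (q^(4ℓ+1);q⁴)_∞) = (q⁴;q⁴)_∞ / ((q;q⁴)_∞ (q³;q⁴)_∞) = (q⁴;q⁴)_∞ / (q;q²)_∞,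
-- which mod 2, where (q²;q²)_∞ = (q;q)_∞², is (q;q)_∞ (q⁴;q⁴)_∞. By Euler's pentagonal theorem the
-- coefficient of q^N is then the parity of the number of ways to write N = ω₁ + 4 ω₄ with generalized
-- pentagonal numbers ω₁, ω₄, that is, 24N + 5 = x² + 4y² with x² = 24 ω₁ + 1 and y² = 24 ω₄ + 1.
-- For the residues r of the statement, 24N + 5 is divisible by 7 but not by 49, whereas
-- 7 ∣ x² + 4y² forces 49 ∣ x² + 4y².
-- Everything is computed with power series over 𝔽₂ truncated at some q^B. The q-binomial step is
-- replaced by the recurrence (1 + q^(4j+1)) H j = (1 + q^(4j+4)) H (j+1) for the series H j obtained
-- by enlarging the parts of ρ, which telescopes into the product formula; Euler's theorem mod 2
-- comes from Shanks' finite form of it.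
module Submission where

open import Algebra.Bundles using (AbelianGroup; CommutativeRing)
import Algebra.Construct.Pointwise as Pointwise
import Algebra.Properties.AbelianGroup as AbelianGroupProperties
import Algebra.Properties.CommutativeSemigroup as CommutativeSemigroupProperties
import Algebra.Properties.Monoid as MonoidProperties
open import Data.Bool using (Bool; true; false; _xor_; _∧_; _∨_; not; T; if_then_else_)
open import Data.Bool.Properties
  using (xor-∧-commutativeRing; xor-identityʳ; xor-assoc; not-involutive;
         ∧-comm; ∧-zeroʳ; ∧-identityʳ; ∧-distribˡ-xor; ∧-distribʳ-xor)
open import Data.Empty using (⊥; ⊥-elim)
open import Data.List using (List; []; _∷_; _++_; [_]; map; concatMap; length; replicate; filterᵇ; upTo; downFrom)
open import Data.List.Membership.Propositional using (_∈_)
open import Data.List.Membership.Propositional.Properties using (∈-upTo⁺)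
open import Data.List.Properties using (upTo-∷ʳ)
open import Data.List.Relation.Unary.All as All using (All; []; _∷_; all?)
open import Data.List.Relation.Unary.All.Properties using (++⁺; map⁺)
open import Data.List.Relation.Unary.Any using (here; there)
open import Data.Nat using (ℕ; zero; suc; _+_; _*_; _∸_; _≤_; _<_; z≤n; s≤s; _≡ᵇ_; _≤ᵇ_; >-nonZero)
open import Data.Nat.DivMod using (_%_; %-distribˡ-+; %-distribˡ-*; [m+kn]%n≡m%n; m%n<n)
open import Data.Nat.Divisibility using (_∣_; divides; ∣-refl; ∣m∣n⇒∣m+n)
open import Data.Nat.Induction using (<-rec)
open import Data.Nat.ListAction using (sum)
open import Data.Nat.Properties
open import Data.Nat.Tactic.RingSolver using (solve-∀)
open import Data.Product using (∃-syntax; _×_; _,_)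
open import Data.Sum using (_⊎_; inj₁; inj₂)
open import Defs
open import Function.Bundles using (mk⇔)
open import Relation.Binary.Bundles using (Setoid)
open import Relation.Binary.PropositionalEquality hiding ([_])
import Relation.Binary.Reasoning.Setoid as SetoidReasoning
open import Relation.Nullary using (yes; no)
open import Relation.Nullary.Decidable using (dec-true; dec-false; does-⇔; toWitness; T?)

Series : Set
Series = ℕ → Bool

infix 4 _≋_ _≈[_]_
infixl 6 _⊕_
infixl 7 _·_

_≋_ : Series → Series → Set
f ≋ g = ∀ n → f n ≡ g n

-- agreement modulo q^b
_≈[_]_ : Series → ℕ → Series → Set
f ≈[ b ] g = ∀ n → n < b → f n ≡ g n

_⊕_ : Series → Series → Series
(f ⊕ g) n = f n xor g n

𝟘 𝟙 : Series
𝟘 _ = false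
𝟙 zero = true
𝟙 (suc _) = false

xor-abelianGroup : AbelianGroup _ _
xor-abelianGroup = CommutativeRing.+-abelianGroup xor-∧-commutativeRing

open AbelianGroupProperties xor-abelianGroup using () renaming (∙-cancelʳ to xor-cancelʳ)
open CommutativeSemigroupProperties (AbelianGroup.commutativeSemigroup xor-abelianGroup)
  using () renaming (interchange to xor-interchange)

⊕-abelianGroup : AbelianGroup _ _
⊕-abelianGroup = Pointwise.abelianGroup ℕ xor-abelianGroup

open AbelianGroup ⊕-abelianGroup
  using ()
  renaming (refl to ≋-refl; sym to ≋-sym; trans to ≋-trans; setoid to ≋-setoid;
            ∙-cong to ⊕-cong; assoc to ⊕-assoc; comm to ⊕-comm;
            identityʳ to ⊕-identityʳ; inverseʳ to ⊕-self)
open CommutativeSemigroupProperties (AbelianGroup.commutativeSemigroup ⊕-abelianGroup)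
  using (x∙yz≈xz∙y) renaming (interchange to ⊕-interchange; x∙yz≈y∙xz to ⊕-leftComm)
open MonoidProperties (AbelianGroup.monoid ⊕-abelianGroup) using (cancelˡ; cancelᶜ)

⊕-congˡ : ∀ f {g h} → g ≋ h → f ⊕ g ≋ f ⊕ h
⊕-congˡ f g≋h n = cong (f n xor_) (g≋h n)

⊕-congʳ : ∀ h {f g} → f ≋ g → f ⊕ h ≋ g ⊕ h
⊕-congʳ h f≋g n = cong (_xor h n) (f≋g n)

⊕-cancelˡ : ∀ f g → f ⊕ (f ⊕ g) ≋ g
⊕-cancelˡ f = cancelˡ {a = f} {c = f} (⊕-self f)

⊕-cancel-middle : ∀ f g h → (f ⊕ g) ⊕ (g ⊕ h) ≋ f ⊕ h
⊕-cancel-middle f g = cancelᶜ {a = g} {c = g} (⊕-self g) f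

⊕-cancel-inner : ∀ f g h → (f ⊕ (g ⊕ h)) ⊕ g ≋ f ⊕ h
⊕-cancel-inner f g h = ≋-trans (⊕-assoc f (g ⊕ h) g) (⊕-congˡ f (≋-trans (⊕-comm (g ⊕ h) g) (⊕-cancelˡ g h)))

≡⇒≋ : ∀ {f g} → f ≡ g → f ≋ g
≡⇒≋ refl _ = refl

≋⇒≈ : ∀ {f g} b → f ≋ g → f ≈[ b ] g
≋⇒≈ _ f≋g n _ = f≋g n

≈-refl : ∀ {f b} → f ≈[ b ] f
≈-refl _ _ = refl

≈-sym : ∀ {f g b} → f ≈[ b ] g → g ≈[ b ] f
≈-sym f≈g n n<b = sym (f≈g n n<b)

≈-trans : ∀ {f g h b} → f ≈[ b ] g → g ≈[ b ] h → f ≈[ b ] h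
≈-trans f≈g g≈h n n<b = trans (f≈g n n<b) (g≈h n n<b)

≈-weaken : ∀ {f g b b′} → b′ ≤ b → f ≈[ b ] g → f ≈[ b′ ] g
≈-weaken b′≤b f≈g n n<b′ = f≈g n (≤-trans n<b′ b′≤b)

≈-setoid : ℕ → Setoid _ _
≈-setoid b = record
  { Carrier = Series
  ; _≈_ = _≈[ b ]_
  ; isEquivalence = record { refl = ≈-refl ; sym = ≈-sym ; trans = ≈-trans }
  }

⊕-cong≈ : ∀ {f f′ g g′ b} → f ≈[ b ] f′ → g ≈[ b ] g′ → f ⊕ g ≈[ b ] f′ ⊕ g′
⊕-cong≈ f≈f′ g≈g′ n n<b = cong₂ _xor_ (f≈f′ n n<b) (g≈g′ n n<b)

shift : ℕ → Series → Series
shift zero f = f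
shift (suc k) f zero = false
shift (suc k) f (suc n) = shift k f n

shift-< : ∀ k f {n} → n < k → shift k f n ≡ false
shift-< (suc k) f {zero} _ = refl
shift-< (suc k) f {suc n} (s≤s n<k) = shift-< k f n<k

shift-+ : ∀ k f m → shift k f (k + m) ≡ f m
shift-+ zero f m = refl
shift-+ (suc k) f m = shift-+ k f m

shift-≥ : ∀ k f {n} → k ≤ n → shift k f n ≡ f (n ∸ k)
shift-≥ k f {n} k≤n = trans (cong (shift k f) (sym (m+[n∸m]≡n k≤n))) (shift-+ k f (n ∸ k))

shift-≡ : ∀ {a b} f → a ≡ b → shift a f ≋ shift b f
shift-≡ f refl = ≋-refl

shift-cong : ∀ k {f g b} → f ≈[ b ] g → shift k f ≈[ k + b ] shift k g
shift-cong zero f≈g = f≈g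
shift-cong (suc k) f≈g zero _ = refl
shift-cong (suc k) f≈g (suc n) (s≤s n<k+b) = shift-cong k f≈g n n<k+b

shift-cong′ : ∀ k {f g b} → f ≈[ b ] g → shift k f ≈[ b ] shift k g
shift-cong′ k {b = b} f≈g = ≈-weaken (m≤n+m b k) (shift-cong k f≈g)

shift-cong≋ : ∀ k {f g} → f ≋ g → shift k f ≋ shift k g
shift-cong≋ zero f≋g = f≋g
shift-cong≋ (suc k) f≋g zero = refl
shift-cong≋ (suc k) f≋g (suc n) = shift-cong≋ k f≋g n

shift-⊕ : ∀ k f g → shift k (f ⊕ g) ≋ shift k f ⊕ shift k g
shift-⊕ zero f g n = refl
shift-⊕ (suc k) f g zero = refl
shift-⊕ (suc k) f g (suc n) = shift-⊕ k f g n

shift-shift : ∀ a b f → shift a (shift b f) ≋ shift (a + b) f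
shift-shift zero b f n = refl
shift-shift (suc a) b f zero = refl
shift-shift (suc a) b f (suc n) = shift-shift a b f n

shift-comm : ∀ a b f → shift a (shift b f) ≋ shift b (shift a f)
shift-comm a b f = ≋-trans (shift-shift a b f) (≋-trans (shift-≡ f (+-comm a b)) (≋-sym (shift-shift b a f)))

shift-𝟘 : ∀ k → shift k 𝟘 ≋ 𝟘
shift-𝟘 zero n = refl
shift-𝟘 (suc k) zero = refl
shift-𝟘 (suc k) (suc n) = shift-𝟘 k n

shift-≈𝟘 : ∀ k {f b} → f ≈[ b ] 𝟘 → shift k f ≈[ k + b ] 𝟘
shift-≈𝟘 k f≈𝟘 n n<k+b = trans (shift-cong k f≈𝟘 n n<k+b) (shift-𝟘 k n)

shift-low : ∀ k f → shift k f ≈[ k ] 𝟘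
shift-low k f n n<k = shift-< k f n<k

1+q^ : ℕ → Series → Series
1+q^ k f = f ⊕ shift k f

1+q^-cong : ∀ k {f g b} → f ≈[ b ] g → 1+q^ k f ≈[ b ] 1+q^ k g
1+q^-cong k f≈g = ⊕-cong≈ f≈g (shift-cong′ k f≈g)

1+q^-cong≋ : ∀ k {f g} → f ≋ g → 1+q^ k f ≋ 1+q^ k g
1+q^-cong≋ k f≋g = ⊕-cong f≋g (shift-cong≋ k f≋g)

1+q^-≡ : ∀ {a b} f → a ≡ b → 1+q^ a f ≋ 1+q^ b f
1+q^-≡ f refl = ≋-refl

1+q^-⊕ : ∀ k f g → 1+q^ k (f ⊕ g) ≋ 1+q^ k f ⊕ 1+q^ k g
1+q^-⊕ k f g = ≋-trans (⊕-congˡ (f ⊕ g) (shift-⊕ k f g)) (⊕-interchange f g (shift k f) (shift k g))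

1+q^-shift : ∀ k a f → 1+q^ k (shift a f) ≋ shift a (1+q^ k f)
1+q^-shift k a f = ≋-trans (⊕-congˡ (shift a f) (shift-comm k a f)) (≋-sym (shift-⊕ a f (shift k f)))

1+q^-comm : ∀ a b f → 1+q^ a (1+q^ b f) ≋ 1+q^ b (1+q^ a f)
1+q^-comm a b f = ≋-trans (1+q^-⊕ a f (shift b f)) (⊕-congˡ (1+q^ a f) (1+q^-shift a b f))

1+q^-square : ∀ a f → 1+q^ a (1+q^ a f) ≋ 1+q^ (a + a) f
1+q^-square a f =
  ≋-trans (1+q^-comm a a f)
  (≋-trans (⊕-congˡ (1+q^ a f) (shift-⊕ a f (shift a f)))
  (≋-trans (⊕-cancel-middle f (shift a f) (shift a (shift a f)))
           (⊕-congˡ f (shift-shift a a f))))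

1+q^-zero : ∀ f → 1+q^ 0 f ≋ 𝟘
1+q^-zero f = ⊕-self f

1+q^-low : ∀ k f → 1+q^ k f ≈[ k ] f
1+q^-low k f n n<k = trans (cong (f n xor_) (shift-< k f n<k)) (xor-identityʳ (f n))

-- f n is recovered from ((1 + q^k) f) n and f (n − k).
1+q^-injective : ∀ k {f g b} → 1 ≤ k → 1+q^ k f ≈[ b ] 1+q^ k g → f ≈[ b ] g
1+q^-injective k {f} {g} {b} 1≤k eq = <-rec (λ n → n < b → f n ≡ g n) step
  where
  step : ∀ n → (∀ {m} → m < n → m < b → f m ≡ g m) → n < b → f n ≡ g n
  step n ih n<b = xor-cancelʳ (shift k f n) (f n) (g n) (trans (eq n n<b) (cong (g n xor_) (sym shifts-agree)))
    where
    shifts-agree : shift k f n ≡ shift k g n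
    shifts-agree with k ≤? n
    ... | no k≰n = trans (shift-< k f (≰⇒> k≰n)) (sym (shift-< k g (≰⇒> k≰n)))
    ... | yes k≤n = trans (shift-≥ k f k≤n) (trans (ih n∸k<n (<-trans n∸k<n n<b)) (sym (shift-≥ k g k≤n)))
      where
      n∸k<n : n ∸ k < n
      n∸k<n = ∸-monoʳ-< 1≤k k≤n

∏1+q^ : (ℕ → ℕ) → ℕ → Series → Series
∏1+q^ e zero f = f
∏1+q^ e (suc n) f = 1+q^ (e n) (∏1+q^ e n f)

∏-cong : ∀ e n {f g b} → f ≈[ b ] g → ∏1+q^ e n f ≈[ b ] ∏1+q^ e n g
∏-cong e zero f≈g = f≈g
∏-cong e (suc n) f≈g = 1+q^-cong (e n) (∏-cong e n f≈g)

∏-cong≋ : ∀ e n {f g} → f ≋ g → ∏1+q^ e n f ≋ ∏1+q^ e n g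
∏-cong≋ e zero f≋g = f≋g
∏-cong≋ e (suc n) f≋g = 1+q^-cong≋ (e n) (∏-cong≋ e n f≋g)

∏-≡ : ∀ e {m n} f → m ≡ n → ∏1+q^ e m f ≋ ∏1+q^ e n f
∏-≡ e f refl = ≋-refl

∏-ext : ∀ e e′ n f → (∀ i → i < n → e i ≡ e′ i) → ∏1+q^ e n f ≋ ∏1+q^ e′ n f
∏-ext e e′ zero f e≡e′ = ≋-refl
∏-ext e e′ (suc n) f e≡e′ =
  ≋-trans (1+q^-≡ (∏1+q^ e n f) (e≡e′ n ≤-refl))
          (1+q^-cong≋ (e′ n) (∏-ext e e′ n f (λ i i<n → e≡e′ i (m≤n⇒m≤1+n i<n))))

∏-1+q^ : ∀ e n k f → ∏1+q^ e n (1+q^ k f) ≋ 1+q^ k (∏1+q^ e n f)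
∏-1+q^ e zero k f = ≋-refl
∏-1+q^ e (suc n) k f = ≋-trans (1+q^-cong≋ (e n) (∏-1+q^ e n k f)) (1+q^-comm (e n) k (∏1+q^ e n f))

∏-∏ : ∀ e n e′ n′ f → ∏1+q^ e n (∏1+q^ e′ n′ f) ≋ ∏1+q^ e′ n′ (∏1+q^ e n f)
∏-∏ e n e′ zero f = ≋-refl
∏-∏ e n e′ (suc n′) f =
  ≋-trans (∏-1+q^ e n (e′ n′) (∏1+q^ e′ n′ f)) (1+q^-cong≋ (e′ n′) (∏-∏ e n e′ n′ f))

∏-first : ∀ e n f → ∏1+q^ e (suc n) f ≋ 1+q^ (e 0) (∏1+q^ (λ i → e (suc i)) n f)
∏-first e zero f = ≋-refl
∏-first e (suc n) f =
  ≋-trans (1+q^-cong≋ (e (suc n)) (∏-first e n f)) (1+q^-comm (e (suc n)) (e 0) (∏1+q^ (λ i → e (suc i)) n f))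

∏-square : ∀ e n f → ∏1+q^ e n (∏1+q^ e n f) ≋ ∏1+q^ (λ i → e i + e i) n f
∏-square e zero f = ≋-refl
∏-square e (suc n) f =
  ≋-trans (1+q^-cong≋ (e n) (∏-1+q^ e n (e n) (∏1+q^ e n f)))
  (≋-trans (1+q^-square (e n) (∏1+q^ e n (∏1+q^ e n f)))
           (1+q^-cong≋ (e n + e n) (∏-square e n f)))

∏-interleave : ∀ e n f → ∏1+q^ e (n + n) f ≋ ∏1+q^ (λ i → e (suc (i + i))) n (∏1+q^ (λ i → e (i + i)) n f)
∏-interleave e zero f = ≋-refl
∏-interleave e (suc n) f =
  ≋-trans (∏-≡ e f (+-suc (suc n) n))
  (1+q^-cong≋ (e (suc (n + n)))
    (≋-trans (1+q^-cong≋ (e (n + n)) (∏-interleave e n f))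
             (≋-sym (∏-1+q^ (λ i → e (suc (i + i))) n (e (n + n)) (∏1+q^ (λ i → e (i + i)) n f)))))

∏-telescope : ∀ e e′ (F : ℕ → Series) J {b} →
              (∀ j → j < J → 1+q^ (e j) (F j) ≈[ b ] 1+q^ (e′ j) (F (suc j))) →
              ∏1+q^ e J (F 0) ≈[ b ] ∏1+q^ e′ J (F J)
∏-telescope e e′ F zero step = ≈-refl
∏-telescope e e′ F (suc J) {b} step =
  ≈-trans (1+q^-cong (e J) (∏-telescope e e′ F J (λ j j<J → step j (m≤n⇒m≤1+n j<J))))
  (≈-trans (≋⇒≈ b (≋-sym (∏-1+q^ e′ J (e J) (F J))))
  (≈-trans (∏-cong e′ J (step J ≤-refl))
           (≋⇒≈ b (∏-1+q^ e′ J (e′ J) (F (suc J))))))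

∏-injective : ∀ e n {f g b} → (∀ i → i < n → 1 ≤ e i) →
              ∏1+q^ e n f ≈[ b ] ∏1+q^ e n g → f ≈[ b ] g
∏-injective e zero _ eq = eq
∏-injective e (suc n) e≥1 eq =
  ∏-injective e n (λ i i<n → e≥1 i (m≤n⇒m≤1+n i<n)) (1+q^-injective (e n) (e≥1 n ≤-refl) eq)

∏-truncate : ∀ e n d f {b} → (∀ i → n ≤ i → b ≤ e i) → ∏1+q^ e (n + d) f ≈[ b ] ∏1+q^ e n f
∏-truncate e n zero f _ = ≋⇒≈ _ (∏-≡ e f (+-identityʳ n))
∏-truncate e n (suc d) f e≥b =
  ≈-trans (≋⇒≈ _ (∏-≡ e f (+-suc n d)))
  (≈-trans (≈-weaken (e≥b (n + d) (m≤m+n n d)) (1+q^-low (e (n + d)) (∏1+q^ e (n + d) f)))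
           (∏-truncate e n d f e≥b))

∑ : ℕ → (ℕ → Series) → Series
∑ zero F = 𝟘
∑ (suc n) F = ∑ n F ⊕ F n

∑-cong : ∀ n {F G b} → (∀ k → k < n → F k ≈[ b ] G k) → ∑ n F ≈[ b ] ∑ n G
∑-cong zero _ = ≈-refl
∑-cong (suc n) F≈G = ⊕-cong≈ (∑-cong n (λ k k<n → F≈G k (m≤n⇒m≤1+n k<n))) (F≈G n ≤-refl)

∑-cong≋ : ∀ n {F G} → (∀ k → k < n → F k ≋ G k) → ∑ n F ≋ ∑ n G
∑-cong≋ zero _ = ≋-refl
∑-cong≋ (suc n) F≋G = ⊕-cong (∑-cong≋ n (λ k k<n → F≋G k (m≤n⇒m≤1+n k<n))) (F≋G n ≤-refl)

∑-⊕ : ∀ n F G → ∑ n (λ k → F k ⊕ G k) ≋ ∑ n F ⊕ ∑ n G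
∑-⊕ zero F G = ≋-refl
∑-⊕ (suc n) F G =
  ≋-trans (⊕-congʳ (F n ⊕ G n) (∑-⊕ n F G)) (⊕-interchange (∑ n F) (∑ n G) (F n) (G n))

∑-head : ∀ n F → ∑ (suc n) F ≋ F 0 ⊕ ∑ n (λ k → F (suc k))
∑-head zero F = ≋-sym (⊕-identityʳ (F 0))
∑-head (suc n) F =
  ≋-trans (⊕-congʳ (F (suc n)) (∑-head n F)) (⊕-assoc (F 0) (∑ n (λ k → F (suc k))) (F (suc n)))

∑-𝟘 : ∀ n → ∑ n (λ _ → 𝟘) ≋ 𝟘
∑-𝟘 zero = ≋-refl
∑-𝟘 (suc n) = ⊕-congʳ 𝟘 (∑-𝟘 n)

∑-≈𝟘 : ∀ n {F b} → (∀ k → k < n → F k ≈[ b ] 𝟘) → ∑ n F ≈[ b ] 𝟘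
∑-≈𝟘 n F≈𝟘 = ≈-trans (∑-cong n F≈𝟘) (≋⇒≈ _ (∑-𝟘 n))

∑-last-≈𝟘 : ∀ n F {b} → F n ≈[ b ] 𝟘 → ∑ (suc n) F ≈[ b ] ∑ n F
∑-last-≈𝟘 n F Fn≈𝟘 = ≈-trans (⊕-cong≈ (≈-refl {∑ n F}) Fn≈𝟘) (≋⇒≈ _ (⊕-identityʳ (∑ n F)))

∑-telescope : ∀ n (G : ℕ → Series) → ∑ n (λ k → G (suc k) ⊕ G k) ≋ G n ⊕ G 0
∑-telescope zero G = ≋-sym (⊕-self (G 0))
∑-telescope (suc n) G =
  ≋-trans (⊕-congʳ (G (suc n) ⊕ G n) (∑-telescope n G))
  (≋-trans (⊕-cong (⊕-comm (G n) (G 0)) (⊕-comm (G (suc n)) (G n)))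
  (≋-trans (⊕-cancel-middle (G 0) (G n) (G (suc n)))
           (⊕-comm (G 0) (G (suc n)))))

shift-∑ : ∀ a n F → shift a (∑ n F) ≋ ∑ n (λ k → shift a (F k))
shift-∑ a zero F = shift-𝟘 a
shift-∑ a (suc n) F = ≋-trans (shift-⊕ a (∑ n F) (F n)) (⊕-congʳ (shift a (F n)) (shift-∑ a n F))

-- the Cauchy product, unfolded along the first factor
_·_ : Series → Series → Series
(f · g) zero = f 0 ∧ g 0
(f · g) (suc n) = (f 0 ∧ g (suc n)) xor ((λ i → f (suc i)) · g) n

·-ext : ∀ n {f f′ g g′} → (∀ i → i ≤ n → f i ≡ f′ i) → (∀ i → i ≤ n → g i ≡ g′ i) →
        (f · g) n ≡ (f′ · g′) n
·-ext zero f≡f′ g≡g′ = cong₂ _∧_ (f≡f′ 0 z≤n) (g≡g′ 0 z≤n)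
·-ext (suc n) f≡f′ g≡g′ =
  cong₂ _xor_ (cong₂ _∧_ (f≡f′ 0 z≤n) (g≡g′ (suc n) ≤-refl))
              (·-ext n (λ i i≤n → f≡f′ (suc i) (s≤s i≤n)) (λ i i≤n → g≡g′ i (m≤n⇒m≤1+n i≤n)))

·-cong : ∀ {f f′ g g′ b} → f ≈[ b ] f′ → g ≈[ b ] g′ → f · g ≈[ b ] f′ · g′
·-cong f≈f′ g≈g′ n n<b =
  ·-ext n (λ i i≤n → f≈f′ i (≤-<-trans i≤n n<b)) (λ i i≤n → g≈g′ i (≤-<-trans i≤n n<b))

·-cong≋ : ∀ {f f′ g g′} → f ≋ f′ → g ≋ g′ → f · g ≋ f′ · g′
·-cong≋ f≋f′ g≋g′ n = ·-ext n (λ i _ → f≋f′ i) (λ i _ → g≋g′ i)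

·-zeroˡ : ∀ g → 𝟘 · g ≋ 𝟘
·-zeroˡ g zero = refl
·-zeroˡ g (suc n) = ·-zeroˡ g n

·-identityˡ : ∀ g → 𝟙 · g ≋ g
·-identityˡ g zero = refl
·-identityˡ g (suc n) = trans (cong (g (suc n) xor_) (·-zeroˡ g n)) (xor-identityʳ _)

·-identityʳ : ∀ f → f · 𝟙 ≋ f
·-identityʳ f zero = ∧-identityʳ (f 0)
·-identityʳ f (suc n) =
  trans (cong (_xor ((λ i → f (suc i)) · 𝟙) n) (∧-zeroʳ (f 0))) (·-identityʳ (λ i → f (suc i)) n)

·-≈𝟘ˡ : ∀ {f b} g → f ≈[ b ] 𝟘 → f · g ≈[ b ] 𝟘
·-≈𝟘ˡ g f≈𝟘 = ≈-trans (·-cong f≈𝟘 (≈-refl {g})) (≋⇒≈ _ (·-zeroˡ g))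

·-distribʳ-⊕ : ∀ f f′ g → (f ⊕ f′) · g ≋ f · g ⊕ f′ · g
·-distribʳ-⊕ f f′ g zero = ∧-distribʳ-xor (g 0) (f 0) (f′ 0)
·-distribʳ-⊕ f f′ g (suc n) =
  trans (cong₂ _xor_ (∧-distribʳ-xor (g (suc n)) (f 0) (f′ 0)) (·-distribʳ-⊕ (λ i → f (suc i)) (λ i → f′ (suc i)) g n))
        (xor-interchange (f 0 ∧ g (suc n)) (f′ 0 ∧ g (suc n)) _ _)

·-distribˡ-⊕ : ∀ f g g′ → f · (g ⊕ g′) ≋ f · g ⊕ f · g′
·-distribˡ-⊕ f g g′ zero = ∧-distribˡ-xor (f 0) (g 0) (g′ 0)
·-distribˡ-⊕ f g g′ (suc n) =
  trans (cong₂ _xor_ (∧-distribˡ-xor (f 0) (g (suc n)) (g′ (suc n))) (·-distribˡ-⊕ (λ i → f (suc i)) g g′ n))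
        (xor-interchange (f 0 ∧ g (suc n)) (f 0 ∧ g′ (suc n)) _ _)

·-shiftˡ : ∀ a f g → shift a f · g ≋ shift a (f · g)
·-shiftˡ zero f g n = refl
·-shiftˡ (suc a) f g zero = refl
·-shiftˡ (suc a) f g (suc n) = ·-shiftˡ a f g n

·-shift1ʳ : ∀ f g → f · shift 1 g ≋ shift 1 (f · g)
·-shift1ʳ f g zero = ∧-zeroʳ (f 0)
·-shift1ʳ f g (suc zero) = trans (cong ((f 0 ∧ g 0) xor_) (∧-zeroʳ (f 1))) (xor-identityʳ _)
·-shift1ʳ f g (suc (suc n)) = cong ((f 0 ∧ g (suc n)) xor_) (·-shift1ʳ (λ i → f (suc i)) g (suc n))

·-shiftʳ : ∀ a f g → f · shift a g ≋ shift a (f · g)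
·-shiftʳ zero f g = ≋-refl
·-shiftʳ (suc a) f g =
  ≋-trans (·-cong≋ (≋-refl {f}) (≋-sym (shift-shift 1 a g)))
  (≋-trans (·-shift1ʳ f (shift a g))
  (≋-trans (shift-cong≋ 1 (·-shiftʳ a f g)) (shift-shift 1 a (f · g))))

·-1+q^ˡ : ∀ k f g → 1+q^ k f · g ≋ 1+q^ k (f · g)
·-1+q^ˡ k f g = ≋-trans (·-distribʳ-⊕ f (shift k f) g) (⊕-congˡ (f · g) (·-shiftˡ k f g))

∏-· : ∀ e n f g → ∏1+q^ e n f · g ≋ ∏1+q^ e n (f · g)
∏-· e zero f g = ≋-refl
∏-· e (suc n) f g = ≋-trans (·-1+q^ˡ (e n) (∏1+q^ e n f) g) (1+q^-cong≋ (e n) (∏-· e n f g))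

triangular : ℕ → ℕ
triangular zero = 0
triangular (suc k) = triangular k + suc k

-- n(3n+1)/2 and (n+1)(3n+2)/2
pentagonal⁺ pentagonal⁻ : ℕ → ℕ
pentagonal⁺ n = n * n + triangular n
pentagonal⁻ n = pentagonal⁺ n + suc (n + n)

-- Σ_{|j| ≤ n} q^(c j(3j−1)/2)
pentagonalSeries : ℕ → ℕ → Series
pentagonalSeries c zero = 𝟙
pentagonalSeries c (suc n) =
  pentagonalSeries c n ⊕ shift (c * pentagonal⁻ n) 𝟙 ⊕ shift (c * pentagonal⁺ (suc n)) 𝟙

-- multiplication by (q^c;q^c)_n, which mod 2 is ∏_{1 ≤ i ≤ n} (1 + q^(ci))
poch : ℕ → ℕ → Series → Series
poch c = ∏1+q^ (λ i → c * suc i)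

pochFrom : ℕ → ℕ → ℕ → Series
pochFrom c k d = ∏1+q^ (λ i → c * (k + suc i)) d 𝟙

-- Shanks' finite form of Euler's pentagonal theorem, mod 2.
module Shanks (c : ℕ) where

  term : ℕ → ℕ → Series
  term n k = shift (c * (n * k + triangular k)) (pochFrom c k (n ∸ k))

  shanks : ℕ → Series
  shanks n = ∑ (suc n) (term n)

  boundary : ℕ → ℕ → Series
  boundary n zero = 𝟘
  boundary n (suc k) = shift (c * (suc n + k)) (term n k)

  pochFrom-peel : ∀ k d → 1+q^ (c * suc k) (pochFrom c (suc k) d) ≋ pochFrom c k (suc d)
  pochFrom-peel k d = ≋-sym (≋-trans (∏-first (λ i → c * (k + suc i)) d 𝟙)
    (≋-trans (1+q^-≡ (∏1+q^ (λ i → c * (k + suc (suc i))) d 𝟙) (cong (c *_) (+-comm k 1)))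
    (1+q^-cong≋ (c * suc k)
      (∏-ext (λ i → c * (k + suc (suc i))) (λ i → c * (suc k + suc i)) d 𝟙
             (λ i _ → cong (c *_) (+-suc k (suc i)))))))

  pochFrom-empty : ∀ k {d} → d ≡ 0 → pochFrom c k d ≋ 𝟙
  pochFrom-empty k refl = ≋-refl

  term-suc : ∀ n k → k ≤ n → term (suc n) k ≋ shift (c * k) (term n k) ⊕ boundary n (suc k)
  term-suc n k k≤n =
    ≋-trans (shift-cong≋ e pochFrom-extend)
    (≋-trans (shift-⊕ e W (shift (c * suc n) W))
    (⊕-cong (≋-trans (shift-≡ W (arith₁ c n k (triangular k))) (≋-sym (shift-shift (c * k) _ W)))
            (≋-trans (shift-shift e (c * suc n) W)
            (≋-trans (shift-≡ W (arith₂ c n k (triangular k))) (≋-sym (shift-shift (c * (suc n + k)) _ W))))))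
    where
    e : ℕ
    e = c * (suc n * k + triangular k)
    W : Series
    W = pochFrom c k (n ∸ k)
    pochFrom-extend : pochFrom c k (suc n ∸ k) ≋ 1+q^ (c * suc n) W
    pochFrom-extend rewrite +-∸-assoc 1 k≤n =
      1+q^-≡ W (cong (c *_) (trans (+-suc k (n ∸ k)) (cong suc (m+[n∸m]≡n k≤n))))
    arith₁ : ∀ c n k t → c * (suc n * k + t) ≡ c * k + c * (n * k + t)
    arith₁ = solve-∀
    arith₂ : ∀ c n k t → c * (suc n * k + t) + c * suc n ≡ c * (suc n + k) + c * (n * k + t)
    arith₂ = solve-∀

  1+q^-term : ∀ n k → k ≤ n → 1+q^ (c * k) (term n k) ≋ boundary n k
  1+q^-term n zero _ = ≋-trans (1+q^-≡ (term n 0) (*-zeroʳ c)) (1+q^-zero (term n 0))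
  1+q^-term n (suc k) k<n =
    ≋-trans (1+q^-shift (c * suc k) e (pochFrom c (suc k) (n ∸ suc k)))
    (≋-trans (shift-cong≋ e (pochFrom-peel k (n ∸ suc k)))
    (≋-trans (shift-cong≋ e (≡⇒≋ (cong (pochFrom c k) (sym (+-∸-assoc 1 k<n)))))
    (≋-trans (shift-≡ W (sym (arith c n k (triangular k))))
             (≋-sym (shift-shift (c * (suc n + k)) (c * (n * k + triangular k)) W)))))
    where
    e : ℕ
    e = c * (n * suc k + triangular (suc k))
    W : Series
    W = pochFrom c k (n ∸ k)
    arith : ∀ c n k t → c * (suc n + k) + c * (n * k + t) ≡ c * (n * suc k + (t + suc k))
    arith = solve-∀

  term-step : ∀ n k → k ≤ n → term (suc n) k ≋ term n k ⊕ (boundary n (suc k) ⊕ boundary n k)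
  term-step n k k≤n =
    ≋-trans (term-suc n k k≤n)
    (≋-trans (⊕-congʳ (boundary n (suc k)) shifted)
    (≋-trans (⊕-assoc (term n k) (boundary n k) (boundary n (suc k)))
             (⊕-congˡ (term n k) (⊕-comm (boundary n k) (boundary n (suc k))))))
    where
    shifted : shift (c * k) (term n k) ≋ term n k ⊕ boundary n k
    shifted = ≋-trans (≋-sym (⊕-cancelˡ (term n k) (shift (c * k) (term n k))))
                      (⊕-congˡ (term n k) (1+q^-term n k k≤n))

  shanks-step : ∀ n → shanks (suc n) ≋ shanks n ⊕ shift (c * pentagonal⁻ n) 𝟙 ⊕ shift (c * pentagonal⁺ (suc n)) 𝟙
  shanks-step n = ⊕-cong old-terms new-term
    where
    top : boundary n (suc n) ≋ shift (c * pentagonal⁻ n) 𝟙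
    top = ≋-trans (shift-cong≋ (c * (suc n + n)) (shift-cong≋ (c * pentagonal⁺ n) (pochFrom-empty n (n∸n≡0 n))))
          (≋-trans (shift-shift (c * (suc n + n)) (c * pentagonal⁺ n) 𝟙)
                   (shift-≡ 𝟙 (trans (sym (*-distribˡ-+ c (suc n + n) (pentagonal⁺ n))) (cong (c *_) (arith n (triangular n))))))
      where
      arith : ∀ n t → suc n + n + (n * n + t) ≡ n * n + t + suc (n + n)
      arith = solve-∀
    old-terms : ∑ (suc n) (term (suc n)) ≋ shanks n ⊕ shift (c * pentagonal⁻ n) 𝟙
    old-terms =
      ≋-trans (∑-cong≋ (suc n) (λ k k<1+n → term-step n k (≤-pred k<1+n)))
      (≋-trans (∑-⊕ (suc n) (term n) (λ k → boundary n (suc k) ⊕ boundary n k))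
               (⊕-congˡ (shanks n) (≋-trans (∑-telescope (suc n) (boundary n))
                                              (≋-trans (⊕-identityʳ (boundary n (suc n))) top))))
    new-term : term (suc n) (suc n) ≋ shift (c * pentagonal⁺ (suc n)) 𝟙
    new-term = shift-cong≋ (c * pentagonal⁺ (suc n)) (pochFrom-empty (suc n) (n∸n≡0 n))

  shanks≋pentagonalSeries : ∀ n → shanks n ≋ pentagonalSeries c n
  shanks≋pentagonalSeries zero = shift-≡ 𝟙 (*-zeroʳ c)
  shanks≋pentagonalSeries (suc n) =
    ≋-trans (shanks-step n)
            (⊕-congʳ (shift (c * pentagonal⁺ (suc n)) 𝟙) (⊕-congʳ (shift (c * pentagonal⁻ n) 𝟙) (shanks≋pentagonalSeries n)))

  -- Only the k = 0 term of Shanks' sum survives below q^(c(n+1)).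
  poch≈pentagonalSeries : ∀ n → poch c n 𝟙 ≈[ c * suc n ] pentagonalSeries c n
  poch≈pentagonalSeries n =
    ≈-trans higher-terms-vanish
            (≋⇒≈ _ (≋-trans (≋-sym (∑-head n (term n))) (shanks≋pentagonalSeries n)))
    where
    exponent-large : ∀ k → suc n ≤ n * suc k + triangular (suc k)
    exponent-large k = subst (_≤ n * suc k + triangular (suc k)) (+-comm n 1)
      (+-mono-≤ (m≤m*n n (suc k)) (subst (1 ≤_) (sym (+-comm (triangular k) (suc k))) (s≤s z≤n)))
    higher-terms-vanish : poch c n 𝟙 ≈[ c * suc n ] term n 0 ⊕ ∑ n (λ k → term n (suc k))
    higher-terms-vanish =
      ≈-trans (≋⇒≈ _ (≋-trans (≋-sym (shift-≡ (poch c n 𝟙) (arith c n))) (≋-sym (⊕-identityʳ (term n 0)))))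
      (⊕-cong≈ (≈-refl {term n 0})
        (≈-sym (∑-≈𝟘 n (λ k _ → ≈-weaken (*-monoʳ-≤ c (exponent-large k)) (shift-low _ _)))))
      where
      arith : ∀ c n → c * (n * 0 + 0) ≡ 0
      arith = solve-∀

-- partitions into exactly ℓ parts taken from the decreasing list L, counted mod 2
partitionsGF : List ℕ → ℕ → Series
partitionsGF L zero = 𝟙
partitionsGF [] (suc ℓ) = 𝟘
partitionsGF (p ∷ ps) (suc ℓ) = shift p (partitionsGF (p ∷ ps) ℓ) ⊕ partitionsGF ps (suc ℓ)

partitionsGF-translate : ∀ c L ℓ → partitionsGF (map (c +_) L) ℓ ≋ shift (c * ℓ) (partitionsGF L ℓ)
partitionsGF-translate c L zero = ≋-sym (shift-≡ 𝟙 (*-zeroʳ c))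
partitionsGF-translate c [] (suc ℓ) = ≋-sym (shift-𝟘 (c * suc ℓ))
partitionsGF-translate c (p ∷ L) (suc ℓ) =
  ≋-trans (⊕-cong largest-part (partitionsGF-translate c L (suc ℓ)))
          (≋-sym (shift-⊕ (c * suc ℓ) (shift p P) (partitionsGF L (suc ℓ))))
  where
  P : Series
  P = partitionsGF (p ∷ L) ℓ
  largest-part : shift (c + p) (partitionsGF (map (c +_) (p ∷ L)) ℓ) ≋ shift (c * suc ℓ) (shift p P)
  largest-part =
    ≋-trans (shift-cong≋ (c + p) (partitionsGF-translate c (p ∷ L) ℓ))
    (≋-trans (shift-shift (c + p) (c * ℓ) P)
    (≋-trans (shift-≡ P (arith c p ℓ)) (≋-sym (shift-shift (c * suc ℓ) p P))))
    where
    arith : ∀ c p ℓ → c + p + c * ℓ ≡ c * suc ℓ + p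
    arith = solve-∀

partitionsGF-∷ʳ : ∀ L p ℓ → partitionsGF (L ++ [ p ]) (suc ℓ) ≋ shift p (partitionsGF (L ++ [ p ]) ℓ) ⊕ partitionsGF L (suc ℓ)
partitionsGF-∷ʳ [] p ℓ = ≋-refl
partitionsGF-∷ʳ (x ∷ L) p zero =
  ≋-trans (⊕-congˡ (shift x 𝟙) (partitionsGF-∷ʳ L p zero))
          (⊕-leftComm (shift x 𝟙) (shift p 𝟙) (partitionsGF L 1))
partitionsGF-∷ʳ (x ∷ L) p (suc ℓ) = begin
  shift x (P (x ∷ L′) (suc ℓ)) ⊕ P L′ (2+ ℓ)
    ≈⟨ ⊕-cong (shift-cong≋ x (partitionsGF-∷ʳ (x ∷ L) p ℓ)) (partitionsGF-∷ʳ L p (suc ℓ)) ⟩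
  shift x (shift p (P (x ∷ L′) ℓ) ⊕ P (x ∷ L) (suc ℓ)) ⊕ (shift p (P L′ (suc ℓ)) ⊕ P L (2+ ℓ))
    ≈⟨ ⊕-congʳ (shift p (P L′ (suc ℓ)) ⊕ P L (2+ ℓ)) (shift-⊕ x (shift p (P (x ∷ L′) ℓ)) (P (x ∷ L) (suc ℓ))) ⟩
  (shift x (shift p (P (x ∷ L′) ℓ)) ⊕ shift x (P (x ∷ L) (suc ℓ))) ⊕ (shift p (P L′ (suc ℓ)) ⊕ P L (2+ ℓ))
    ≈⟨ ⊕-interchange (shift x (shift p (P (x ∷ L′) ℓ))) (shift x (P (x ∷ L) (suc ℓ)))
                     (shift p (P L′ (suc ℓ))) (P L (2+ ℓ)) ⟩
  (shift x (shift p (P (x ∷ L′) ℓ)) ⊕ shift p (P L′ (suc ℓ))) ⊕ (shift x (P (x ∷ L) (suc ℓ)) ⊕ P L (2+ ℓ))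
    ≈⟨ ⊕-congʳ (P (x ∷ L) (2+ ℓ)) (⊕-congʳ (shift p (P L′ (suc ℓ))) (shift-comm x p (P (x ∷ L′) ℓ))) ⟩
  (shift p (shift x (P (x ∷ L′) ℓ)) ⊕ shift p (P L′ (suc ℓ))) ⊕ P (x ∷ L) (2+ ℓ)
    ≈⟨ ⊕-congʳ (P (x ∷ L) (2+ ℓ)) (shift-⊕ p (shift x (P (x ∷ L′) ℓ)) (P L′ (suc ℓ))) ⟨
  shift p (P (x ∷ L′) (suc ℓ)) ⊕ P (x ∷ L) (2+ ℓ) ∎
  where
  open SetoidReasoning ≋-setoid
  P : List ℕ → ℕ → Series
  P = partitionsGF
  L′ : List ℕ
  L′ = L ++ [ p ]
  2+ : ℕ → ℕ
  2+ ℓ = suc (suc ℓ)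

partitionsGF-below : ∀ p L ℓ → partitionsGF (p ∷ L) ℓ ≈[ p ] partitionsGF L ℓ
partitionsGF-below p L zero = ≈-refl
partitionsGF-below p L (suc ℓ) n n<p = cong (_xor _) (shift-< p _ n<p)

partitionsGF-≈𝟘 : ∀ a L → All (a ≤_) L → ∀ ℓ → partitionsGF L ℓ ≈[ a * ℓ ] 𝟘
partitionsGF-≈𝟘 a L _ zero n n<a*0 = ⊥-elim (n≮0 (subst (n <_) (*-zeroʳ a) n<a*0))
partitionsGF-≈𝟘 a [] _ (suc ℓ) = ≈-refl
partitionsGF-≈𝟘 a (p ∷ L) (a≤p ∷ a≤L) (suc ℓ) =
  ⊕-cong≈ (≈-weaken bound (shift-≈𝟘 p (partitionsGF-≈𝟘 a (p ∷ L) (a≤p ∷ a≤L) ℓ)))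
          (partitionsGF-≈𝟘 a L a≤L (suc ℓ))
  where
  bound : a * suc ℓ ≤ p + a * ℓ
  bound = subst (_≤ p + a * ℓ) (sym (*-suc a ℓ)) (+-monoˡ-≤ (a * ℓ) a≤p)

progression : ℕ → ℕ → ℕ → List ℕ
progression m a s = map (λ t → a + t * m) (downFrom (suc s))

progression-suc : ∀ m a s → progression m a (suc s) ≡ map (m +_) (progression m a s) ++ [ a ]
progression-suc m a zero = cong₂ _∷_ (arith m a) (cong [_] (+-identityʳ a))
  where
  arith : ∀ m a → a + 1 * m ≡ m + (a + 0 * m)
  arith = solve-∀
progression-suc m a (suc s) = cong₂ _∷_ (arith m a s) (progression-suc m a s)
  where
  arith : ∀ m a s → a + suc (suc s) * m ≡ m + (a + suc s * m)
  arith = solve-∀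

progression-≥ : ∀ m a s → All (a ≤_) (progression m a s)
progression-≥ m a zero = m≤m+n a (0 * m) ∷ []
progression-≥ m a (suc s) = m≤m+n a (suc s * m) ∷ progression-≥ m a s

-- Partitions into ℓ+1 parts ≡ a (mod m): split off the smallest part when it is a,
-- otherwise subtract m from every part.
progressionGF-suc : ∀ m a K ℓ → let P = partitionsGF (progression m a (suc K)) in
  P (suc ℓ) ≈[ a + suc K * m ] shift a (P ℓ) ⊕ shift (m * suc ℓ) (P (suc ℓ))
progressionGF-suc m a K ℓ =
  ≈-trans (≋⇒≈ _ (≋-trans (≡⇒≋ (cong (λ L → partitionsGF L (suc ℓ)) (progression-suc m a K)))
                          (partitionsGF-∷ʳ (map (m +_) (progression m a K)) a ℓ)))
          (⊕-cong≈ (≋⇒≈ _ (shift-cong≋ a (≡⇒≋ (cong (λ L → partitionsGF L ℓ) (sym (progression-suc m a K))))))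
                   (≈-trans (≋⇒≈ _ (partitionsGF-translate m (progression m a K) (suc ℓ)))
                            (shift-cong′ (m * suc ℓ) (≈-sym (partitionsGF-below (a + suc K * m) (progression m a K) (suc ℓ))))))

allPartitionsGF : ℕ → List ℕ → Series
allPartitionsGF b L = ∑ (suc b) (partitionsGF L)

allPartitionsGF-[] : ∀ b → allPartitionsGF b [] ≋ 𝟙
allPartitionsGF-[] b = ≋-trans (∑-head b (partitionsGF [])) (≋-trans (⊕-congˡ 𝟙 (∑-𝟘 b)) (⊕-identityʳ 𝟙))

-- (1 + q^p) cancels the geometric series 1/(1 − q^p) of the parts equal to p.
1+q^-allPartitionsGF : ∀ b p ps → All (1 ≤_) (p ∷ ps) →
                       1+q^ p (allPartitionsGF b (p ∷ ps)) ≈[ b ] allPartitionsGF b ps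
1+q^-allPartitionsGF b p ps parts≥1 =
  ≈-trans (⊕-cong≈ (≋⇒≈ b split) shifted)
          (≋⇒≈ b (≋-trans (⊕-cancel-inner 𝟙 S₁ S₂) (≋-sym (∑-head b (partitionsGF ps)))))
  where
  Z : Series
  Z = allPartitionsGF b (p ∷ ps)
  S₁ S₂ : Series
  S₁ = ∑ b (λ ℓ → shift p (partitionsGF (p ∷ ps) ℓ))
  S₂ = ∑ b (λ ℓ → partitionsGF ps (suc ℓ))
  split : Z ≋ 𝟙 ⊕ (S₁ ⊕ S₂)
  split = ≋-trans (∑-head b (partitionsGF (p ∷ ps)))
                  (⊕-congˡ 𝟙 (∑-⊕ b (λ ℓ → shift p (partitionsGF (p ∷ ps) ℓ)) (λ ℓ → partitionsGF ps (suc ℓ))))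
  top-vanishes : partitionsGF (p ∷ ps) b ≈[ b ] 𝟘
  top-vanishes = ≈-weaken (≤-reflexive (sym (*-identityˡ b))) (partitionsGF-≈𝟘 1 (p ∷ ps) parts≥1 b)
  shifted : shift p Z ≈[ b ] S₁
  shifted = ≈-trans (shift-cong′ p (∑-last-≈𝟘 b (partitionsGF (p ∷ ps)) top-vanishes))
                    (≋⇒≈ b (shift-∑ p b (partitionsGF (p ∷ ps))))

∏-progression-allPartitionsGF : ∀ b m a K → 1 ≤ a →
  ∏1+q^ (λ j → a + j * m) (suc K) (allPartitionsGF b (progression m a K)) ≈[ b ] 𝟙
∏-progression-allPartitionsGF b m a zero a≥1 =
  ≈-trans (1+q^-allPartitionsGF b (a + 0 * m) [] (≤-trans a≥1 (m≤m+n a (0 * m)) ∷ []))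
          (≋⇒≈ b (allPartitionsGF-[] b))
∏-progression-allPartitionsGF b m a (suc K) a≥1 =
  ≈-trans (≋⇒≈ b (≋-sym (∏-1+q^ e (suc K) (e (suc K)) (allPartitionsGF b (progression m a (suc K))))))
  (≈-trans (∏-cong e (suc K) (1+q^-allPartitionsGF b (e (suc K)) (progression m a K) parts≥1))
           (∏-progression-allPartitionsGF b m a K a≥1))
  where
  e : ℕ → ℕ
  e = λ j → a + j * m
  parts≥1 : All (1 ≤_) (progression m a (suc K))
  parts≥1 = All.map (≤-trans a≥1) (progression-≥ m a (suc K))

-- Below q^B: G ℓ counts the γ with ℓ parts, S k the σ with k parts, R t = Σ_k q^(m t k) S k the
-- pairs (ρ, σ) when γ has t parts, so H 0 = Σ_ℓ G ℓ · R ℓ counts the (a, b, m)-copartitions.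
module Copartitions (a b m B₀ : ℕ) (a≥1 : 1 ≤ a) (b≥1 : 1 ≤ b) (m≥1 : 1 ≤ m) where

  B : ℕ
  B = suc B₀

  G S R H : ℕ → Series
  G ℓ = partitionsGF (progression m a B) ℓ
  S k = partitionsGF (progression m b B) k
  R t = ∑ (suc B) (λ k → shift (k * (m * t)) (S k))
  H j = ∑ (suc B) (λ ℓ → G ℓ · R (ℓ + j))

  B≤progression : ∀ c → B ≤ c + suc B₀ * m
  B≤progression c = ≤-trans (m≤m*n B m {{>-nonZero m≥1}}) (m≤n+m (B * m) c)

  G-suc : ∀ ℓ → G (suc ℓ) ≈[ B ] shift a (G ℓ) ⊕ shift (m * suc ℓ) (G (suc ℓ))
  G-suc ℓ = ≈-weaken (B≤progression a) (progressionGF-suc m a B₀ ℓ)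

  S-suc : ∀ k → S (suc k) ≈[ B ] shift b (S k) ⊕ shift (m * suc k) (S (suc k))
  S-suc k = ≈-weaken (B≤progression b) (progressionGF-suc m b B₀ k)

  G-≈𝟘 : ∀ ℓ → G ℓ ≈[ a * ℓ ] 𝟘
  G-≈𝟘 = partitionsGF-≈𝟘 a (progression m a B) (progression-≥ m a B)

  S-≈𝟘 : ∀ k → S k ≈[ b * k ] 𝟘
  S-≈𝟘 = partitionsGF-≈𝟘 b (progression m b B) (progression-≥ m b B)


  R-suc : ∀ t → R t ≈[ B ] R (suc t) ⊕ shift (m * t + b) (R t)
  R-suc t = begin
    R t
      ≈⟨ ≋⇒≈ B (∑-head B F) ⟩
    𝟙 ⊕ ∑ B (λ k → F (suc k))
      ≈⟨ ⊕-cong≈ (≈-refl {𝟙}) (∑-cong B (λ k _ → term k)) ⟩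
    𝟙 ⊕ ∑ B (λ k → X k ⊕ Y k)
      ≈⟨ ≋⇒≈ B (⊕-congˡ 𝟙 (∑-⊕ B X Y)) ⟩
    𝟙 ⊕ (∑ B X ⊕ ∑ B Y)
      ≈⟨ ≋⇒≈ B (x∙yz≈xz∙y 𝟙 (∑ B X) (∑ B Y)) ⟩
    (𝟙 ⊕ ∑ B Y) ⊕ ∑ B X
      ≈⟨ ≋⇒≈ B (⊕-cong (≋-sym (∑-head B F′)) (≋-sym (shift-∑ (m * t + b) B F))) ⟩
    R (suc t) ⊕ shift (m * t + b) (∑ B F)
      ≈⟨ ⊕-cong≈ (≈-refl {R (suc t)}) (shift-cong′ (m * t + b) (≈-sym (∑-last-≈𝟘 B F top-vanishes))) ⟩
    R (suc t) ⊕ shift (m * t + b) (R t) ∎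
    where
    open SetoidReasoning (≈-setoid B)
    F F′ X Y : ℕ → Series
    F k = shift (k * (m * t)) (S k)
    F′ k = shift (k * (m * suc t)) (S k)
    X k = shift (m * t + b) (F k)
    Y k = F′ (suc k)
    term : ∀ k → F (suc k) ≈[ B ] X k ⊕ Y k
    term k = ≈-trans (shift-cong′ e (S-suc k)) (≋⇒≈ B
      (≋-trans (shift-⊕ e (shift b (S k)) (shift (m * suc k) (S (suc k))))
      (⊕-cong (≋-trans (shift-shift e b (S k))
              (≋-trans (shift-≡ (S k) (arith₁ m t k b)) (≋-sym (shift-shift (m * t + b) (k * (m * t)) (S k)))))
              (≋-trans (shift-shift e (m * suc k) (S (suc k))) (shift-≡ (S (suc k)) (arith₂ m t k))))))
      where
      e : ℕ
      e = suc k * (m * t)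
      arith₁ : ∀ m t k b → suc k * (m * t) + b ≡ m * t + b + k * (m * t)
      arith₁ = solve-∀
      arith₂ : ∀ m t k → suc k * (m * t) + m * suc k ≡ suc k * (m * suc t)
      arith₂ = solve-∀
    top-vanishes : F B ≈[ B ] 𝟘
    top-vanishes = ≈-weaken (≤-trans (m≤n*m B b {{>-nonZero b≥1}}) (m≤n+m (b * B) (B * (m * t))))
                            (shift-≈𝟘 (B * (m * t)) (S-≈𝟘 B))

  Y : ℕ → Series
  Y j = ∑ (suc B) (λ ℓ → shift (m * ℓ) (G ℓ) · R (ℓ + j))

  R-index : ∀ ℓ j → R (suc (ℓ + j)) ≋ R (ℓ + suc j)
  R-index ℓ j = ≡⇒≋ (cong R (sym (+-suc ℓ j)))

  H-suc : ∀ j → H j ≈[ B ] H (suc j) ⊕ shift (m * j + b) (Y j)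
  H-suc j =
    ≈-trans (∑-cong (suc B) (λ ℓ _ → term ℓ))
    (≋⇒≈ B (≋-trans (∑-⊕ (suc B) _ _) (⊕-congˡ (H (suc j)) (≋-sym (shift-∑ (m * j + b) (suc B) _)))))
    where
    term : ∀ ℓ → G ℓ · R (ℓ + j) ≈[ B ] G ℓ · R (ℓ + suc j) ⊕ shift (m * j + b) (shift (m * ℓ) (G ℓ) · R (ℓ + j))
    term ℓ = ≈-trans (·-cong (≈-refl {G ℓ}) (R-suc (ℓ + j))) (≋⇒≈ B (≋-trans (·-distribˡ-⊕ (G ℓ) _ _)
      (⊕-cong (·-cong≋ (≋-refl {G ℓ}) (R-index ℓ j))
        (≋-trans (·-shiftʳ (m * (ℓ + j) + b) (G ℓ) (R (ℓ + j)))
        (≋-trans (shift-≡ (G ℓ · R (ℓ + j)) (arith m ℓ j b))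
        (≋-trans (≋-sym (shift-shift (m * j + b) (m * ℓ) (G ℓ · R (ℓ + j))))
                 (shift-cong≋ (m * j + b) (≋-sym (·-shiftˡ (m * ℓ) (G ℓ) (R (ℓ + j)))))))))))
      where
      arith : ∀ m ℓ j b → m * (ℓ + j) + b ≡ m * j + b + m * ℓ
      arith = solve-∀

  shifted-G : ∀ ℓ → shift (m * suc ℓ) (G (suc ℓ)) ≈[ B ] G (suc ℓ) ⊕ shift a (G ℓ)
  shifted-G ℓ = ≈-sym (≈-trans (⊕-cong≈ (G-suc ℓ) (≈-refl {shift a (G ℓ)}))
                       (≋⇒≈ B (≋-trans (⊕-comm (shift a (G ℓ) ⊕ shift (m * suc ℓ) (G (suc ℓ))) (shift a (G ℓ)))
                                       (⊕-cancelˡ (shift a (G ℓ)) (shift (m * suc ℓ) (G (suc ℓ)))))))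

  Y≈ : ∀ j → Y j ≈[ B ] H j ⊕ shift a (H (suc j))
  Y≈ j = begin
    Y j
      ≈⟨ ≋⇒≈ B (∑-head B X) ⟩
    X 0 ⊕ ∑ B (λ ℓ → X (suc ℓ))
      ≈⟨ ⊕-cong≈ (≋⇒≈ B first) (∑-cong B (λ ℓ _ → term ℓ)) ⟩
    G 0 · R j ⊕ ∑ B (λ ℓ → U ℓ ⊕ V ℓ)
      ≈⟨ ≋⇒≈ B (⊕-congˡ (G 0 · R j) (∑-⊕ B U V)) ⟩
    G 0 · R j ⊕ (∑ B U ⊕ ∑ B V)
      ≈⟨ ≋⇒≈ B (≋-sym (⊕-assoc (G 0 · R j) (∑ B U) (∑ B V))) ⟩
    (G 0 · R j ⊕ ∑ B U) ⊕ ∑ B V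
      ≈⟨ ≋⇒≈ B (⊕-cong (≋-sym (∑-head B W)) (≋-sym (shift-∑ a B W′))) ⟩
    H j ⊕ shift a (∑ B W′)
      ≈⟨ ⊕-cong≈ (≈-refl {H j}) (shift-cong′ a (≈-sym (∑-last-≈𝟘 B W′ top-vanishes))) ⟩
    H j ⊕ shift a (H (suc j)) ∎
    where
    open SetoidReasoning (≈-setoid B)
    X U V W W′ : ℕ → Series
    X ℓ = shift (m * ℓ) (G ℓ) · R (ℓ + j)
    U ℓ = G (suc ℓ) · R (suc ℓ + j)
    V ℓ = shift a (G ℓ · R (ℓ + suc j))
    W ℓ = G ℓ · R (ℓ + j)
    W′ ℓ = G ℓ · R (ℓ + suc j)
    first : X 0 ≋ G 0 · R j
    first = ·-cong≋ (shift-≡ (G 0) (*-zeroʳ m)) ≋-refl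
    term : ∀ ℓ → X (suc ℓ) ≈[ B ] U ℓ ⊕ V ℓ
    term ℓ = ≈-trans (·-cong (shifted-G ℓ) (≈-refl {R (suc ℓ + j)}))
      (≋⇒≈ B (≋-trans (·-distribʳ-⊕ (G (suc ℓ)) (shift a (G ℓ)) (R (suc ℓ + j)))
        (⊕-congˡ (U ℓ) (≋-trans (·-shiftˡ a (G ℓ) (R (suc ℓ + j))) (shift-cong≋ a (·-cong≋ ≋-refl (R-index ℓ j)))))))
    top-vanishes : W′ B ≈[ B ] 𝟘
    top-vanishes = ·-≈𝟘ˡ (R (B + suc j)) (≈-weaken (m≤n*m B a {{>-nonZero a≥1}}) (G-≈𝟘 B))

  -- For a + b = m the right-hand factor is 1 + q^(m(j+1)).
  H-rec : ∀ j → 1+q^ (m * j + b) (H j) ≈[ B ] 1+q^ (m * j + b + a) (H (suc j))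
  H-rec j = begin
    H j ⊕ shift e (H j)
      ≈⟨ ⊕-cong≈ (H-suc j) (≈-refl {shift e (H j)}) ⟩
    (H (suc j) ⊕ shift e (Y j)) ⊕ shift e (H j)
      ≈⟨ ⊕-cong≈ (⊕-cong≈ (≈-refl {H (suc j)}) (shift-cong′ e (Y≈ j))) (≈-refl {shift e (H j)}) ⟩
    (H (suc j) ⊕ shift e (H j ⊕ shift a (H (suc j)))) ⊕ shift e (H j)
      ≈⟨ ≋⇒≈ B (⊕-congʳ (shift e (H j)) (⊕-congˡ (H (suc j)) (≋-trans (shift-⊕ e (H j) (shift a (H (suc j))))
                                                               (⊕-congˡ (shift e (H j)) (shift-shift e a (H (suc j))))))) ⟩
    (H (suc j) ⊕ (shift e (H j) ⊕ shift (e + a) (H (suc j)))) ⊕ shift e (H j)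
      ≈⟨ ≋⇒≈ B (⊕-cancel-inner (H (suc j)) (shift e (H j)) (shift (e + a) (H (suc j)))) ⟩
    H (suc j) ⊕ shift (e + a) (H (suc j)) ∎
    where
    open SetoidReasoning (≈-setoid B)
    e : ℕ
    e = m * j + b

  I : Series
  I = allPartitionsGF B (progression m a B)

  R-large : ∀ t → B ≤ m * t + b → R t ≈[ B ] 𝟙
  R-large t B≤ = ≈-trans (≋⇒≈ B (∑-head B F))
    (≈-trans (⊕-cong≈ (≈-refl {𝟙})
                      (∑-≈𝟘 B (λ k _ → ≈-weaken (bound k) (shift-≈𝟘 (suc k * (m * t)) (S-≈𝟘 (suc k))))))
             (≋⇒≈ B (⊕-identityʳ 𝟙)))
    where
    F : ℕ → Series
    F k = shift (k * (m * t)) (S k)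
    bound : ∀ k → B ≤ suc k * (m * t) + b * suc k
    bound k = ≤-trans B≤ (+-mono-≤ (m≤n*m (m * t) (suc k)) (m≤m*n b (suc k)))

  H-large : ∀ J → B ≤ m * J + b → H J ≈[ B ] I
  H-large J B≤ = ∑-cong (suc B) (λ ℓ _ →
    ≈-trans (·-cong (≈-refl {G ℓ}) (R-large (ℓ + J) (bound ℓ))) (≋⇒≈ B (·-identityʳ (G ℓ))))
    where
    bound : ∀ ℓ → B ≤ m * (ℓ + J) + b
    bound ℓ = ≤-trans B≤ (+-monoˡ-≤ b (*-monoʳ-≤ m (m≤n+m J ℓ)))

  ∏-I : ∀ J → J ≤ suc B → B ≤ a + J * m → ∏1+q^ (λ j → a + j * m) J I ≈[ B ] 𝟙
  ∏-I J J≤ B≤ =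
    ≈-trans (≈-sym (∏-truncate e J (suc B ∸ J) I (λ i J≤i → ≤-trans B≤ (+-monoʳ-≤ a (*-monoˡ-≤ m J≤i)))))
    (≈-trans (≋⇒≈ B (∏-≡ e I (m+[n∸m]≡n J≤)))
             (∏-progression-allPartitionsGF B m a B a≥1))
    where
    e : ℕ → ℕ
    e = λ j → a + j * m

oddPoch : ℕ → Series → Series
oddPoch = ∏1+q^ (λ i → suc (i + i))

poch-double : ∀ n f → poch 1 (n + n) f ≋ poch 2 n (oddPoch n f)
poch-double n f =
  ≋-trans (∏-interleave (λ i → 1 * suc i) n f)
  (≋-trans (∏-cong≋ (λ i → 1 * suc (suc (i + i))) n
             (∏-ext (λ i → 1 * suc (i + i)) (λ i → suc (i + i)) n f (λ i _ → *-identityˡ _)))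
           (∏-ext (λ i → 1 * suc (suc (i + i))) (λ i → 2 * suc i) n (oddPoch n f) (λ i _ → arith i)))
  where
  arith : ∀ i → 1 * suc (suc (i + i)) ≡ 2 * suc i
  arith = solve-∀

oddPoch-split : ∀ J f → oddPoch (J + J) f ≋ ∏1+q^ (λ j → 3 + j * 4) J (∏1+q^ (λ j → 4 * j + 1) J f)
oddPoch-split J f =
  ≋-trans (∏-interleave (λ i → suc (i + i)) J f)
  (≋-trans (∏-cong≋ (λ i → suc (suc (i + i) + suc (i + i))) J
             (∏-ext (λ i → suc ((i + i) + (i + i))) (λ j → 4 * j + 1) J f (λ i _ → arith₁ i)))
           (∏-ext (λ i → suc (suc (i + i) + suc (i + i))) (λ j → 3 + j * 4) J _ (λ i _ → arith₃ i)))
  where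
  arith₁ : ∀ i → suc ((i + i) + (i + i)) ≡ 4 * i + 1
  arith₁ = solve-∀
  arith₃ : ∀ i → suc (suc (i + i) + suc (i + i)) ≡ 3 + i * 4
  arith₃ = solve-∀

poch-square : ∀ n f → poch 1 n (poch 1 n f) ≋ poch 2 n f
poch-square n f = ≋-trans (∏-square (λ i → 1 * suc i) n f) (∏-ext _ (λ i → 2 * suc i) n f (λ i _ → arith i))
  where
  arith : ∀ i → 1 * suc i + 1 * suc i ≡ 2 * suc i
  arith = solve-∀

module Copartitions₃₁₄ (J : ℕ) where

  open Copartitions 3 1 4 ((J + J) + (J + J)) (s≤s z≤n) (s≤s z≤n) (s≤s z≤n) public

  private
    n : ℕ
    n = J + J

    B≡ : B ≡ 4 * J + 1
    B≡ = arith J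
      where
      arith : ∀ J → suc ((J + J) + (J + J)) ≡ 4 * J + 1
      arith = solve-∀

  H-telescope : ∏1+q^ (λ j → 4 * j + 1) J (H 0) ≈[ B ] poch 4 J (H J)
  H-telescope =
    ≈-trans (∏-telescope (λ j → 4 * j + 1) (λ j → 4 * j + 1 + 3) H J (λ j _ → H-rec j))
            (≋⇒≈ B (∏-ext (λ j → 4 * j + 1 + 3) (λ j → 4 * suc j) J (H J) (λ j _ → arith j)))
    where
    arith : ∀ j → 4 * j + 1 + 3 ≡ 4 * suc j
    arith = solve-∀

  poch-H0 : poch 1 (n + n) (H 0) ≈[ B ] poch 2 n (poch 4 J 𝟙)
  poch-H0 = begin
    poch 1 (n + n) (H 0)
      ≈⟨ ≋⇒≈ B (poch-double n (H 0)) ⟩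
    poch 2 n (oddPoch n (H 0))
      ≈⟨ ∏-cong _ n (≋⇒≈ B (oddPoch-split J (H 0))) ⟩
    poch 2 n (Q₃ (Q₁ (H 0)))
      ≈⟨ ∏-cong _ n (∏-cong _ J H-telescope) ⟩
    poch 2 n (Q₃ (poch 4 J (H J)))
      ≈⟨ ≋⇒≈ B (∏-cong≋ _ n (∏-∏ _ J _ J (H J))) ⟩
    poch 2 n (poch 4 J (Q₃ (H J)))
      ≈⟨ ∏-cong _ n (∏-cong _ J (∏-cong _ J (H-large J (≤-reflexive B≡)))) ⟩
    poch 2 n (poch 4 J (Q₃ I))
      ≈⟨ ∏-cong _ n (∏-cong _ J (∏-I J J≤ B≤)) ⟩
    poch 2 n (poch 4 J 𝟙) ∎
    where
    open SetoidReasoning (≈-setoid B)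
    Q₁ Q₃ : Series → Series
    Q₁ = ∏1+q^ (λ j → 4 * j + 1) J
    Q₃ = ∏1+q^ (λ j → 3 + j * 4) J
    J≤ : J ≤ suc B
    J≤ = ≤-trans (m≤m+n J J) (≤-trans (m≤m+n n n) (≤-trans (n≤1+n _) (n≤1+n _)))
    B≤ : B ≤ 3 + J * 4
    B≤ = subst (B ≤_) (arith J) (m≤m+n B 2)
      where
      arith : ∀ J → suc ((J + J) + (J + J)) + 2 ≡ 3 + J * 4
      arith = solve-∀

  -- Mod 2, (q;q)_{4J} H₀ = (q²;q²)_{2J} (q⁴;q⁴)_J = (q;q)_{4J}² (q⁴;q⁴)_J below q^B; now cancel (q;q)_{4J}.
  H0≈pentagonal : H 0 ≈[ B ] pentagonalSeries 1 (n + n) · pentagonalSeries 4 J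
  H0≈pentagonal =
    ≈-trans (∏-injective (λ i → 1 * suc i) (n + n) (λ i _ → s≤s z≤n) (≈-trans poch-H0 (≈-sym squared)))
    (≈-trans (≋⇒≈ B product)
             (·-cong (≈-weaken (≤-reflexive (sym (*-identityˡ B))) (Shanks.poch≈pentagonalSeries 1 (n + n)))
                     (≈-weaken B≤4+4J (Shanks.poch≈pentagonalSeries 4 J))))
    where
    X : Series
    X = poch 1 (n + n) (poch 4 J 𝟙)
    squared : poch 1 (n + n) X ≈[ B ] poch 2 n (poch 4 J 𝟙)
    squared = ≈-trans (≋⇒≈ B (poch-square (n + n) (poch 4 J 𝟙)))
                      (∏-truncate (λ i → 2 * suc i) n n (poch 4 J 𝟙) (λ i n≤i →
                        ≤-trans (n≤1+n B) (≤-trans (≤-reflexive (arith J)) (*-monoʳ-≤ 2 (s≤s n≤i)))))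
      where
      arith : ∀ J → suc (suc ((J + J) + (J + J))) ≡ 2 * suc (J + J)
      arith = solve-∀
    product : X ≋ poch 1 (n + n) 𝟙 · poch 4 J 𝟙
    product = ≋-trans (∏-cong≋ (λ i → 1 * suc i) (n + n) (≋-sym (·-identityˡ (poch 4 J 𝟙))))
                      (≋-sym (∏-· (λ i → 1 * suc i) (n + n) 𝟙 (poch 4 J 𝟙)))
    B≤4+4J : B ≤ 4 * suc J
    B≤4+4J = subst (B ≤_) (arith J) (m≤m+n B 3)
      where
      arith : ∀ J → suc ((J + J) + (J + J)) + 3 ≡ 4 * suc J
      arith = solve-∀

parity : ℕ → Bool
parity zero = false
parity (suc n) = not (parity n)

parity≡false⇒even : ∀ n → parity n ≡ false → 2 ∣ n
parity≡false⇒even zero _ = divides 0 refl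
parity≡false⇒even (suc zero) ()
parity≡false⇒even (suc (suc n)) p =
  ∣m∣n⇒∣m+n (∣-refl {2}) (parity≡false⇒even n (trans (sym (not-involutive (parity n))) p))

xorSum : {A : Set} → List A → (A → Bool) → Bool
xorSum [] f = false
xorSum (x ∷ xs) f = f x xor xorSum xs f

module _ {A : Set} where

  parity-filter : (p : A → Bool) (xs : List A) → parity (length (filterᵇ p xs)) ≡ xorSum xs p
  parity-filter p [] = refl
  parity-filter p (x ∷ xs) with p x
  ... | true = cong not (parity-filter p xs)
  ... | false = parity-filter p xs

  xorSum-++ : (xs ys : List A) (f : A → Bool) → xorSum (xs ++ ys) f ≡ xorSum xs f xor xorSum ys f
  xorSum-++ [] ys f = refl
  xorSum-++ (x ∷ xs) ys f = trans (cong (f x xor_) (xorSum-++ xs ys f)) (sym (xor-assoc (f x) _ _))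

  xorSum-cong : (xs : List A) {f g : A → Bool} → (∀ x → f x ≡ g x) → xorSum xs f ≡ xorSum xs g
  xorSum-cong [] _ = refl
  xorSum-cong (x ∷ xs) f≡g = cong₂ _xor_ (f≡g x) (xorSum-cong xs f≡g)

  xorSum-cong-All : (xs : List A) {f g : A → Bool} → All (λ x → f x ≡ g x) xs → xorSum xs f ≡ xorSum xs g
  xorSum-cong-All [] [] = refl
  xorSum-cong-All (x ∷ xs) (fx≡gx ∷ f≡g) = cong₂ _xor_ fx≡gx (xorSum-cong-All xs f≡g)

  xorSum-false : (xs : List A) → xorSum xs (λ _ → false) ≡ false
  xorSum-false [] = refl
  xorSum-false (x ∷ xs) = xorSum-false xs

  xorSum-xor : (xs : List A) (f g : A → Bool) → xorSum xs (λ x → f x xor g x) ≡ xorSum xs f xor xorSum xs g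
  xorSum-xor [] f g = refl
  xorSum-xor (x ∷ xs) f g =
    trans (cong ((f x xor g x) xor_) (xorSum-xor xs f g)) (xor-interchange (f x) (g x) (xorSum xs f) (xorSum xs g))

module _ {A B : Set} where

  xorSum-concatMap : (g : A → List B) (xs : List A) (f : B → Bool) →
                     xorSum (concatMap g xs) f ≡ xorSum xs (λ x → xorSum (g x) f)
  xorSum-concatMap g [] f = refl
  xorSum-concatMap g (x ∷ xs) f =
    trans (xorSum-++ (g x) (concatMap g xs) f) (cong (xorSum (g x) f xor_) (xorSum-concatMap g xs f))

  xorSum-map : (g : A → B) (xs : List A) (f : B → Bool) → xorSum (map g xs) f ≡ xorSum xs (λ x → f (g x))
  xorSum-map g [] f = refl
  xorSum-map g (x ∷ xs) f = cong (f (g x) xor_) (xorSum-map g xs f)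

  xorSum-comm : (xs : List A) (ys : List B) (h : A → B → Bool) →
                xorSum xs (λ x → xorSum ys (h x)) ≡ xorSum ys (λ y → xorSum xs (λ x → h x y))
  xorSum-comm [] ys h = sym (xorSum-false ys)
  xorSum-comm (x ∷ xs) ys h =
    trans (cong (xorSum ys (h x) xor_) (xorSum-comm xs ys h)) (sym (xorSum-xor ys (h x) (λ y → xorSum xs (λ x′ → h x′ y))))

xorSumBelow : ℕ → (ℕ → Bool) → Bool
xorSumBelow n = xorSum (upTo n)

xorSumBelow-suc : ∀ n f → xorSumBelow (suc n) f ≡ xorSumBelow n f xor f n
xorSumBelow-suc n f =
  trans (cong (λ xs → xorSum xs f) (sym (upTo-∷ʳ n)))
        (trans (xorSum-++ (upTo n) [ n ] f) (cong (xorSumBelow n f xor_) (xor-identityʳ (f n))))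

xorSumBelow-cong : ∀ n {f g} → (∀ x → x < n → f x ≡ g x) → xorSumBelow n f ≡ xorSumBelow n g
xorSumBelow-cong zero _ = refl
xorSumBelow-cong (suc n) {f} {g} f≡g =
  trans (xorSumBelow-suc n f)
  (trans (cong₂ _xor_ (xorSumBelow-cong n (λ x x<n → f≡g x (m≤n⇒m≤1+n x<n))) (f≡g n ≤-refl))
         (sym (xorSumBelow-suc n g)))

xorSumBelow-head : ∀ n f → xorSumBelow (suc n) f ≡ f 0 xor xorSumBelow n (λ i → f (suc i))
xorSumBelow-head zero f = refl
xorSumBelow-head (suc n) f =
  trans (xorSumBelow-suc (suc n) f)
  (trans (cong (_xor f (suc n)) (xorSumBelow-head n f))
  (trans (xor-assoc (f 0) _ _) (cong (f 0 xor_) (sym (xorSumBelow-suc n (λ i → f (suc i)))))))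

∑-coefficient : ∀ n F x → ∑ n F x ≡ xorSumBelow n (λ k → F k x)
∑-coefficient zero F x = refl
∑-coefficient (suc n) F x = trans (cong (_xor F n x) (∑-coefficient n F x)) (sym (xorSumBelow-suc n (λ k → F k x)))

·-coefficient : ∀ f g n → (f · g) n ≡ xorSumBelow (suc n) (λ i → f i ∧ g (n ∸ i))
·-coefficient f g zero = sym (xor-identityʳ _)
·-coefficient f g (suc n) =
  trans (cong ((f 0 ∧ g (suc n)) xor_) (·-coefficient (λ i → f (suc i)) g n))
        (sym (xorSumBelow-head (suc n) (λ i → f i ∧ g (suc n ∸ i))))

xorSumBelow-indicator-≥ : ∀ m c (G : ℕ → Bool) → m ≤ c → xorSumBelow m (λ ℓ → (c ≡ᵇ ℓ) ∧ G ℓ) ≡ false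
xorSumBelow-indicator-≥ zero c G _ = refl
xorSumBelow-indicator-≥ (suc m) c G m<c =
  trans (xorSumBelow-suc m _)
        (cong₂ _xor_ (xorSumBelow-indicator-≥ m c G (<⇒≤ m<c))
                     (cong (_∧ G m) (dec-false (c ≟ m) (λ c≡m → <-irrefl (sym c≡m) m<c))))

xorSumBelow-indicator : ∀ m c (G : ℕ → Bool) → c < m → xorSumBelow m (λ ℓ → (c ≡ᵇ ℓ) ∧ G ℓ) ≡ G c
xorSumBelow-indicator (suc m) c G c<1+m with m≤n⇒m<n∨m≡n (≤-pred c<1+m)
... | inj₁ c<m =
  trans (xorSumBelow-suc m _)
  (trans (cong₂ _xor_ (xorSumBelow-indicator m c G c<m) (cong (_∧ G m) (dec-false (c ≟ m) (λ c≡m → <-irrefl c≡m c<m))))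
         (xor-identityʳ (G c)))
... | inj₂ refl =
  trans (xorSumBelow-suc m _)
        (cong₂ _xor_ (xorSumBelow-indicator-≥ m m G ≤-refl) (cong (_∧ G m) (dec-true (m ≟ m) refl)))

xorSumBelow-single : ∀ N c g → xorSumBelow (suc N) (λ s → g s ∧ (c + s ≡ᵇ N)) ≡ shift c g N
xorSumBelow-single N c g with c ≤? N
... | yes c≤N =
  trans (xorSumBelow-cong (suc N) (λ s _ → trans (∧-comm (g s) _) (cong (_∧ g s) (same-test s))))
  (trans (xorSumBelow-indicator (suc N) (N ∸ c) g (s≤s (m∸n≤m N c))) (sym (shift-≥ c g c≤N)))
  where
  same-test : ∀ s → (c + s ≡ᵇ N) ≡ (N ∸ c ≡ᵇ s)
  same-test s = does-⇔ (mk⇔ (λ c+s≡N → trans (cong (_∸ c) (sym c+s≡N)) (m+n∸m≡n c s))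
                              (λ N∸c≡s → trans (cong (c +_) (sym N∸c≡s)) (m+[n∸m]≡n c≤N)))
                         (c + s ≟ N) (N ∸ c ≟ s)
... | no c≰N =
  trans (xorSumBelow-cong (suc N) (λ s _ →
           trans (cong (g s ∧_) (dec-false (c + s ≟ N) (λ c+s≡N → c≰N (subst (c ≤_) c+s≡N (m≤m+n c s))))) (∧-zeroʳ (g s))))
  (trans (xorSum-false (upTo (suc N))) (sym (shift-< c g (≰⇒> c≰N))))

xorSum-byLength : {A : Set} (xs : List A) (len : A → ℕ) (m : ℕ) (G : ℕ → Bool) → All (λ x → len x < m) xs →
                  xorSum xs (λ x → G (len x)) ≡ xorSumBelow m (λ ℓ → xorSum xs (λ x → len x ≡ᵇ ℓ) ∧ G ℓ)
xorSum-byLength [] len m G [] = sym (xorSum-false (upTo m))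
xorSum-byLength (x ∷ xs) len m G (lenx<m ∷ len<m) =
  trans (cong (G (len x) xor_) (xorSum-byLength xs len m G len<m))
  (sym (trans (xorSum-cong (upTo m) (λ ℓ → ∧-distribʳ-xor (G ℓ) (len x ≡ᵇ ℓ) (xorSum xs (λ y → len y ≡ᵇ ℓ))))
       (trans (xorSum-xor (upTo m) (λ ℓ → (len x ≡ᵇ ℓ) ∧ G ℓ) (λ ℓ → xorSum xs (λ y → len y ≡ᵇ ℓ) ∧ G ℓ))
              (cong (_xor xorSumBelow m (λ ℓ → xorSum xs (λ y → len y ≡ᵇ ℓ) ∧ G ℓ)) (xorSumBelow-indicator m (len x) G lenx<m)))))

go-sound : ∀ f L r → All (1 ≤_) L → r ≤ f → All (λ γ → sum γ ≡ r × length γ ≤ r) (go f L r)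
go-sound f L zero _ _ = (refl , z≤n) ∷ []
go-sound (suc f) [] (suc r) _ _ = []
go-sound (suc f) (suc p ∷ ps) (suc r) (p≥1 ∷ ps≥1) r<f =
  ++⁺ (with-largest (suc p ≤ᵇ suc r) refl) (go-sound (suc f) ps (suc r) ps≥1 r<f)
  where
  rest : All (λ γ → sum γ ≡ r ∸ p × length γ ≤ r ∸ p) (go f (suc p ∷ ps) (r ∸ p))
  rest = go-sound f (suc p ∷ ps) (suc r ∸ suc p) (p≥1 ∷ ps≥1) (≤-trans (m∸n≤m r p) (≤-pred r<f))
  with-largest : ∀ t → (suc p ≤ᵇ suc r) ≡ t →
    All (λ γ → sum γ ≡ suc r × length γ ≤ suc r) (if t then map (suc p ∷_) (go f (suc p ∷ ps) (suc r ∸ suc p)) else [])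
  with-largest true p≤ᵇr =
    map⁺ (All.map (λ (sum≡ , len≤) → trans (cong (suc p +_) sum≡) (m+[n∸m]≡n p≤r) , s≤s (≤-trans len≤ (m∸n≤m r p))) rest)
    where
    p≤r : suc p ≤ suc r
    p≤r = ≤ᵇ⇒≤ (suc p) (suc r) (subst T (sym p≤ᵇr) _)
  with-largest false _ = []

xorSum-go-length : ∀ f L r ℓ → All (1 ≤_) L → r ≤ f → xorSum (go f L r) (λ γ → length γ ≡ᵇ ℓ) ≡ partitionsGF L ℓ r
xorSum-go-length f L zero zero _ _ = refl
xorSum-go-length f L zero (suc ℓ) L≥1 _ = sym (partitionsGF-≈𝟘 1 L L≥1 (suc ℓ) 0 (s≤s z≤n))
xorSum-go-length (suc f) [] (suc r) zero _ _ = refl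
xorSum-go-length (suc f) [] (suc r) (suc ℓ) _ _ = refl
xorSum-go-length (suc f) (suc p ∷ ps) (suc r) ℓ (p≥1 ∷ ps≥1) r<f =
  trans (xorSum-++ (largest (suc p ≤ᵇ suc r)) (go (suc f) ps (suc r)) _)
  (trans (cong (xorSum (largest (suc p ≤ᵇ suc r)) (λ γ → length γ ≡ᵇ ℓ) xor_) (xorSum-go-length (suc f) ps (suc r) ℓ ps≥1 r<f))
         (with-largest (suc p ≤ᵇ suc r) refl ℓ))
  where
  smaller : List (List ℕ)
  smaller = go f (suc p ∷ ps) (suc r ∸ suc p)
  largest : Bool → List (List ℕ)
  largest t = if t then map (suc p ∷_) smaller else []
  with-largest : ∀ t → (suc p ≤ᵇ suc r) ≡ t → ∀ ℓ →
    xorSum (largest t) (λ γ → length γ ≡ᵇ ℓ) xor partitionsGF ps ℓ (suc r) ≡ partitionsGF (suc p ∷ ps) ℓ (suc r)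
  with-largest true _ zero = cong (_xor false) (trans (xorSum-map (suc p ∷_) smaller _) (xorSum-false smaller))
  with-largest true p≤ᵇr (suc ℓ) =
    cong (_xor partitionsGF ps (suc ℓ) (suc r))
      (trans (xorSum-map (suc p ∷_) smaller _)
      (trans (xorSum-go-length f (suc p ∷ ps) (suc r ∸ suc p) ℓ (p≥1 ∷ ps≥1) (≤-trans (m∸n≤m r p) (≤-pred r<f)))
             (sym (shift-≥ (suc p) (partitionsGF (suc p ∷ ps) ℓ) (≤ᵇ⇒≤ (suc p) (suc r) (subst T (sym p≤ᵇr) _))))))
  with-largest false _ zero = refl
  with-largest false p≰ᵇr (suc ℓ) =
    cong (_xor partitionsGF ps (suc ℓ) (suc r))
         (sym (shift-< (suc p) (partitionsGF (suc p ∷ ps) ℓ) {suc r} (≰⇒> (λ p≤r → subst T p≰ᵇr (≤⇒≤ᵇ p≤r)))))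

sum-replicate : ∀ n v → sum (replicate n v) ≡ n * v
sum-replicate zero v = refl
sum-replicate (suc n) v = cong (v +_) (sum-replicate n v)

partitionsGF-progression-extend : ∀ m a s d ℓ → 1 ≤ m →
  partitionsGF (progression m a (s + d)) ℓ s ≡ partitionsGF (progression m a s) ℓ s
partitionsGF-progression-extend m a s zero ℓ _ = cong (λ k → partitionsGF (progression m a k) ℓ s) (+-identityʳ s)
partitionsGF-progression-extend m a s (suc d) ℓ m≥1 =
  trans (cong (λ k → partitionsGF (progression m a k) ℓ s) (+-suc s d))
  (trans (partitionsGF-below (a + suc (s + d) * m) (progression m a (s + d)) ℓ s s<top)
         (partitionsGF-progression-extend m a s d ℓ m≥1))
  where
  s<top : s < a + suc (s + d) * m
  s<top = ≤-trans (s≤s (m≤m+n s d))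
            (≤-trans (m≤m*n (suc (s + d)) m {{>-nonZero m≥1}})
                     (m≤n+m _ a))

module _ {a m : ℕ} (a≥1 : 1 ≤ a) where

  progression≥1 : ∀ s → All (1 ≤_) (progression m a s)
  progression≥1 s = All.map (≤-trans a≥1) (progression-≥ m a s)

  progPartitions-sound : ∀ s → All (λ γ → sum γ ≡ s × length γ ≤ s) (progPartitions a m s)
  progPartitions-sound s = go-sound s (progression m a s) s (progression≥1 s) ≤-refl

  xorSum-progPartitions-length : ∀ s B ℓ → 1 ≤ m → s ≤ B →
    xorSum (progPartitions a m s) (λ γ → length γ ≡ᵇ ℓ) ≡ partitionsGF (progression m a B) ℓ s
  xorSum-progPartitions-length s B ℓ m≥1 s≤B =
    trans (xorSum-go-length s (progression m a s) s ℓ (progression≥1 s) ≤-refl)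
    (sym (trans (cong (λ k → partitionsGF (progression m a k) ℓ s) (sym (m+[n∸m]≡n s≤B)))
                (partitionsGF-progression-extend m a s (B ∸ s) ℓ m≥1)))

module _ (a b m B₀ N : ℕ) (a≥1 : 1 ≤ a) (b≥1 : 1 ≤ b) (m≥1 : 1 ≤ m) (N≤B₀ : N ≤ B₀) where

  open Copartitions a b m B₀ a≥1 b≥1 m≥1

  private
    ≤N⇒≤B : ∀ {s} → s ≤ N → s ≤ B
    ≤N⇒≤B s≤N = ≤-trans s≤N (≤-trans N≤B₀ (n≤1+n B₀))

    length<B : ∀ {s} → s ≤ N → {xs : List ℕ} → sum xs ≡ s × length xs ≤ s → length xs < suc B
    length<B s≤N (_ , len≤s) = s≤s (≤-trans len≤s (≤N⇒≤B s≤N))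

    size≡ : ℕ → ℕ → ℕ → ℕ → Bool
    size≡ s₁ ℓ s₂ k = s₁ + k * (m * ℓ) + s₂ ≡ᵇ N

    -- pairs (ρ, σ) completing a γ of size s₁ with ℓ parts to size N
    pairs : ℕ → ℕ → Bool
    pairs s₁ ℓ = xorSumBelow (suc N) (λ s₂ → xorSumBelow (suc B) (λ k → S k s₂ ∧ size≡ s₁ ℓ s₂ k))

    copartition : List ℕ → List ℕ → Copartition
    copartition γ σ = (γ , replicate (length σ) (m * length γ) , σ)

    hasSizeN : Copartition → Bool
    hasSizeN c = size c ≡ᵇ N

    parity-cp-expand : parity (cp a b m N) ≡
      xorSumBelow (suc N) (λ s₁ → xorSum (progPartitions a m s₁) (λ γ →
        xorSumBelow (suc N) (λ s₂ → xorSum (progPartitions b m s₂) (λ σ → hasSizeN (copartition γ σ)))))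
    parity-cp-expand =
      trans (parity-filter hasSizeN whole)
      (trans (xorSum-concatMap per-s₁ (upTo (suc N)) hasSizeN)
             (xorSumBelow-cong (suc N) (λ s₁ _ →
               trans (xorSum-concatMap per-γ (progPartitions a m s₁) hasSizeN)
                     (xorSum-cong (progPartitions a m s₁) (λ γ →
                       trans (xorSum-concatMap (per-σ γ) (upTo (suc N)) hasSizeN)
                             (xorSum-cong (upTo (suc N)) (λ s₂ → xorSum-map (copartition γ) (progPartitions b m s₂) hasSizeN)))))))
      where
      per-σ : List ℕ → ℕ → List Copartition
      per-σ γ s₂ = map (copartition γ) (progPartitions b m s₂)
      per-γ : List ℕ → List Copartition
      per-γ γ = concatMap (per-σ γ) (upTo (suc N))
      per-s₁ : ℕ → List Copartition
      per-s₁ s₁ = concatMap per-γ (progPartitions a m s₁)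
      whole : List Copartition
      whole = concatMap per-s₁ (upTo (suc N))

    sum-over-σ : ∀ s₁ s₂ γ → sum γ ≡ s₁ → s₂ ≤ N →
      xorSum (progPartitions b m s₂) (λ σ → hasSizeN (copartition γ σ)) ≡
      xorSumBelow (suc B) (λ k → S k s₂ ∧ size≡ s₁ (length γ) s₂ k)
    sum-over-σ s₁ s₂ γ sumγ s₂≤N =
      trans (xorSum-cong-All (progPartitions b m s₂) {λ σ → hasSizeN (copartition γ σ)} {λ σ → size≡ s₁ (length γ) s₂ (length σ)}
                             (All.map (λ {σ} → size-of {σ}) (progPartitions-sound b≥1 s₂)))
      (trans (xorSum-byLength (progPartitions b m s₂) length (suc B) (size≡ s₁ (length γ) s₂)
                              (All.map (λ {σ} → length<B s₂≤N {σ}) (progPartitions-sound b≥1 s₂)))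
             (xorSumBelow-cong (suc B) (λ k _ →
               cong (_∧ size≡ s₁ (length γ) s₂ k) (xorSum-progPartitions-length b≥1 s₂ B k m≥1 (≤N⇒≤B s₂≤N)))))
      where
      size-of : ∀ {σ} → sum σ ≡ s₂ × length σ ≤ s₂ → hasSizeN (copartition γ σ) ≡ size≡ s₁ (length γ) s₂ (length σ)
      size-of {σ} (sumσ , _) = cong (_≡ᵇ N) (cong₂ _+_ (cong₂ _+_ sumγ (sum-replicate (length σ) (m * length γ))) sumσ)

    sum-over-γ : ∀ s₁ → s₁ ≤ N →
      xorSum (progPartitions a m s₁) (λ γ → pairs s₁ (length γ)) ≡ xorSumBelow (suc B) (λ ℓ → G ℓ s₁ ∧ pairs s₁ ℓ)
    sum-over-γ s₁ s₁≤N =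
      trans (xorSum-byLength (progPartitions a m s₁) length (suc B) (pairs s₁)
                             (All.map (λ {γ} → length<B s₁≤N {γ}) (progPartitions-sound a≥1 s₁)))
            (xorSumBelow-cong (suc B) (λ ℓ _ →
              cong (_∧ pairs s₁ ℓ) (xorSum-progPartitions-length a≥1 s₁ B ℓ m≥1 (≤N⇒≤B s₁≤N))))

    parity-cp : parity (cp a b m N) ≡ xorSumBelow (suc N) (λ s₁ → xorSumBelow (suc B) (λ ℓ → G ℓ s₁ ∧ pairs s₁ ℓ))
    parity-cp =
      trans parity-cp-expand
            (xorSumBelow-cong (suc N) (λ s₁ s₁<1+N →
              trans (xorSum-cong-All (progPartitions a m s₁)
                      {λ γ → xorSumBelow (suc N) (λ s₂ → xorSum (progPartitions b m s₂) (λ σ → hasSizeN (copartition γ σ)))}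
                      {λ γ → pairs s₁ (length γ)}
                      (All.map (λ {γ} (sumγ , _) → xorSumBelow-cong (suc N) (λ s₂ s₂<1+N → sum-over-σ s₁ s₂ γ sumγ (≤-pred s₂<1+N)))
                               (progPartitions-sound a≥1 s₁)))
                    (sum-over-γ s₁ (≤-pred s₁<1+N))))

    pairs≡R : ∀ s₁ ℓ → s₁ ≤ N → pairs s₁ ℓ ≡ R ℓ (N ∸ s₁)
    pairs≡R s₁ ℓ s₁≤N =
      trans (xorSum-comm (upTo (suc N)) (upTo (suc B)) (λ s₂ k → S k s₂ ∧ size≡ s₁ ℓ s₂ k))
      (trans (xorSumBelow-cong (suc B) (λ k _ →
               trans (xorSumBelow-single N (s₁ + k * (m * ℓ)) (S k))
               (trans (sym (shift-shift s₁ (k * (m * ℓ)) (S k) N)) (shift-≥ s₁ (shift (k * (m * ℓ)) (S k)) s₁≤N))))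
             (sym (∑-coefficient (suc B) (λ k → shift (k * (m * ℓ)) (S k)) (N ∸ s₁))))

  parity-cp≡H₀ : parity (cp a b m N) ≡ H 0 N
  parity-cp≡H₀ = begin
    parity (cp a b m N)
      ≡⟨ parity-cp ⟩
    xorSumBelow (suc N) (λ s₁ → xorSumBelow (suc B) (λ ℓ → G ℓ s₁ ∧ pairs s₁ ℓ))
      ≡⟨ xorSumBelow-cong (suc N) (λ s₁ s₁<1+N → xorSumBelow-cong (suc B) (λ ℓ _ →
           cong (G ℓ s₁ ∧_) (trans (pairs≡R s₁ ℓ (≤-pred s₁<1+N)) (cong (λ t → R t (N ∸ s₁)) (sym (+-identityʳ ℓ)))))) ⟩
    xorSumBelow (suc N) (λ s₁ → xorSumBelow (suc B) (λ ℓ → G ℓ s₁ ∧ R (ℓ + 0) (N ∸ s₁)))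
      ≡⟨ xorSum-comm (upTo (suc N)) (upTo (suc B)) (λ s₁ ℓ → G ℓ s₁ ∧ R (ℓ + 0) (N ∸ s₁)) ⟩
    xorSumBelow (suc B) (λ ℓ → xorSumBelow (suc N) (λ s₁ → G ℓ s₁ ∧ R (ℓ + 0) (N ∸ s₁)))
      ≡⟨ xorSumBelow-cong (suc B) (λ ℓ _ → ·-coefficient (G ℓ) (R (ℓ + 0)) N) ⟨
    xorSumBelow (suc B) (λ ℓ → (G ℓ · R (ℓ + 0)) N)
      ≡⟨ ∑-coefficient (suc B) (λ ℓ → G ℓ · R (ℓ + 0)) N ⟨
    H 0 N ∎
    where open ≡-Reasoning

-- 24 ω + 1 = (6j − 1)² for ω = j(3j−1)/2
PentagonalExponent : ℕ → Set
PentagonalExponent e = ∃[ x ] 24 * e + 1 ≡ x * x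

2*triangular : ∀ n → 2 * triangular n ≡ n * suc n
2*triangular zero = refl
2*triangular (suc n) = trans (arith₁ n (triangular n)) (trans (cong (_+ 2 * suc n) (2*triangular n)) (arith₂ n))
  where
  arith₁ : ∀ n t → 2 * (t + suc n) ≡ 2 * t + 2 * suc n
  arith₁ = solve-∀
  arith₂ : ∀ n → n * suc n + 2 * suc n ≡ suc n * suc (suc n)
  arith₂ = solve-∀

pentagonal⁺-exponent : ∀ n → PentagonalExponent (pentagonal⁺ n)
pentagonal⁺-exponent n =
  6 * n + 1 , trans (arith₁ n (triangular n)) (trans (cong (λ t → 24 * (n * n) + 12 * t + 1) (2*triangular n)) (arith₂ n))
  where
  arith₁ : ∀ n t → 24 * (n * n + t) + 1 ≡ 24 * (n * n) + 12 * (2 * t) + 1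
  arith₁ = solve-∀
  arith₂ : ∀ n → 24 * (n * n) + 12 * (n * suc n) + 1 ≡ (6 * n + 1) * (6 * n + 1)
  arith₂ = solve-∀

pentagonal⁻-exponent : ∀ n → PentagonalExponent (pentagonal⁻ n)
pentagonal⁻-exponent n =
  6 * n + 5 , trans (arith₁ n (triangular n))
                    (trans (cong (λ t → 24 * (n * n + suc (n + n)) + 12 * t + 1) (2*triangular n)) (arith₂ n))
  where
  arith₁ : ∀ n t → 24 * (n * n + t + suc (n + n)) + 1 ≡ 24 * (n * n + suc (n + n)) + 12 * (2 * t) + 1
  arith₁ = solve-∀
  arith₂ : ∀ n → 24 * (n * n + suc (n + n)) + 12 * (n * suc n) + 1 ≡ (6 * n + 5) * (6 * n + 5)
  arith₂ = solve-∀

shift-𝟙-support : ∀ k i → shift k 𝟙 i ≡ true → i ≡ k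
shift-𝟙-support zero zero _ = refl
shift-𝟙-support (suc k) (suc i) eq = cong suc (shift-𝟙-support k i eq)

xor₃-true : ∀ x y z → (x xor y) xor z ≡ true → (x ≡ true ⊎ y ≡ true) ⊎ z ≡ true
xor₃-true true _ _ _ = inj₁ (inj₁ refl)
xor₃-true false true _ _ = inj₁ (inj₂ refl)
xor₃-true false false true _ = inj₂ refl

pentagonalSeries-support : ∀ c n i → pentagonalSeries c n i ≡ true → ∃[ e ] i ≡ c * e × PentagonalExponent e
pentagonalSeries-support c zero zero _ = 0 , sym (*-zeroʳ c) , 1 , refl
pentagonalSeries-support c (suc n) i eq
  with xor₃-true (pentagonalSeries c n i) (shift (c * pentagonal⁻ n) 𝟙 i) (shift (c * pentagonal⁺ (suc n)) 𝟙 i) eq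
... | inj₁ (inj₁ old) = pentagonalSeries-support c n i old
... | inj₁ (inj₂ new⁻) = pentagonal⁻ n , shift-𝟙-support _ i new⁻ , pentagonal⁻-exponent n
... | inj₂ new⁺ = pentagonal⁺ (suc n) , shift-𝟙-support _ i new⁺ , pentagonal⁺-exponent (suc n)

residueOK : ℕ → Bool
residueOK v = not (v % 7 ≡ᵇ 0) ∨ (v ≡ᵇ 0)

-- −4 is not a square mod 7, so 7 ∣ x² + 4y² forces 7 ∣ x, y and hence 49 ∣ x² + 4y².
residueOK-table : All (λ u → All (λ v → T (residueOK ((u * u + 4 * (v * v)) % 49))) (upTo 49)) (upTo 49)
residueOK-table = toWitness {a? = all? (λ u → all? (λ v → T? (residueOK ((u * u + 4 * (v * v)) % 49))) (upTo 49)) (upTo 49)} _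

x²+4y²%49 : ∀ x y → (x * x + 4 * (y * y)) % 49 ≡ ((x % 49) * (x % 49) + 4 * ((y % 49) * (y % 49))) % 49
x²+4y²%49 x y =
  trans (%-distribˡ-+ (x * x) (4 * (y * y)) 49)
  (trans (cong₂ (λ s t → (s + t) % 49) (%-distribˡ-* x x 49)
                                        (trans (%-distribˡ-* 4 (y * y) 49) (cong (λ t → (4 * t) % 49) (%-distribˡ-* y y 49))))
  (sym (trans (%-distribˡ-+ (u * u) (4 * (v * v)) 49) (cong (λ t → ((u * u) % 49 + t) % 49) (%-distribˡ-* 4 (v * v) 49)))))
  where
  u : ℕ
  u = x % 49
  v : ℕ
  v = y % 49

residueOK-x²+4y² : ∀ x y → T (residueOK ((x * x + 4 * (y * y)) % 49))
residueOK-x²+4y² x y rewrite x²+4y²%49 x y =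
  All.lookup (All.lookup residueOK-table (∈-upTo⁺ (m%n<n x 49))) (∈-upTo⁺ (m%n<n y 49))

residues : List ℕ
residues = 3 ∷ 17 ∷ 24 ∷ 31 ∷ 38 ∷ 45 ∷ []

x²+4y²≢24N+5 : ∀ k r → r ∈ residues → ∀ x y → x * x + 4 * (y * y) ≢ 24 * (49 * k + r) + 5
x²+4y²≢24N+5 k r r∈ x y eq = bad r∈ (subst (λ v → T (residueOK v)) same-residue (residueOK-x²+4y² x y))
  where
  same-residue : (x * x + 4 * (y * y)) % 49 ≡ (24 * r + 5) % 49
  same-residue = trans (cong (_% 49) (trans eq (arith k r))) ([m+kn]%n≡m%n (24 * r + 5) (24 * k) 49)
    where
    arith : ∀ k r → 24 * (49 * k + r) + 5 ≡ 24 * r + 5 + 24 * k * 49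
    arith = solve-∀
  bad : ∀ {r} → r ∈ residues → T (residueOK ((24 * r + 5) % 49)) → ⊥
  bad (here refl) ()
  bad (there (here refl)) ()
  bad (there (there (here refl))) ()
  bad (there (there (there (here refl)))) ()
  bad (there (there (there (there (here refl))))) ()
  bad (there (there (there (there (there (here refl)))))) ()

∧≡false : ∀ {x y} → (x ≡ true → y ≡ true → ⊥) → x ∧ y ≡ false
∧≡false {false} _ = refl
∧≡false {true} {false} _ = refl
∧≡false {true} {true} both = ⊥-elim (both refl refl)

-- A coefficient of q^N in (q;q)_∞ (q⁴;q⁴)_∞ mod 2 needs 24N + 5 = (24ω₁ + 1) + 4 (24ω₄ + 1) = x² + 4y².
pentagonal-product-vanishes : ∀ n J k r → r ∈ residues →
  (pentagonalSeries 1 n · pentagonalSeries 4 J) (49 * k + r) ≡ false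
pentagonal-product-vanishes n J k r r∈ =
  trans (·-coefficient (pentagonalSeries 1 n) (pentagonalSeries 4 J) N)
  (trans (xorSumBelow-cong (suc N) (λ i i<1+N → ∧≡false (no-pair i (≤-pred i<1+N))))
         (xorSum-false (upTo (suc N))))
  where
  N : ℕ
  N = 49 * k + r
  no-pair : ∀ i → i ≤ N → pentagonalSeries 1 n i ≡ true → pentagonalSeries 4 J (N ∸ i) ≡ true → ⊥
  no-pair i i≤N one four
    with pentagonalSeries-support 1 n i one | pentagonalSeries-support 4 J (N ∸ i) four
  ... | e₁ , i≡ , x , x² | e₄ , N∸i≡ , y , y² =
    x²+4y²≢24N+5 k r r∈ x y (begin
      x * x + 4 * (y * y)
        ≡⟨ cong₂ (λ s t → s + 4 * t) (sym x²) (sym y²) ⟩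
      24 * e₁ + 1 + 4 * (24 * e₄ + 1)
        ≡⟨ arith e₁ e₄ ⟩
      24 * (1 * e₁ + 4 * e₄) + 5
        ≡⟨ cong (λ t → 24 * t + 5) (sym (trans (sym (m+[n∸m]≡n i≤N)) (cong₂ _+_ i≡ N∸i≡))) ⟩
      24 * N + 5 ∎)
    where
    open ≡-Reasoning
    arith : ∀ e₁ e₄ → 24 * e₁ + 1 + 4 * (24 * e₄ + 1) ≡ 24 * (1 * e₁ + 4 * e₄) + 5
    arith = solve-∀

corollary4p8 : (r k : ℕ) → r ∈ (3 ∷ 17 ∷ 24 ∷ 31 ∷ 38 ∷ 45 ∷ []) →
    2 ∣ cp 3 1 4 (49 * k + r)
corollary4p8 r k r∈ = parity≡false⇒even (cp 3 1 4 N) (begin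
  parity (cp 3 1 4 N)
    ≡⟨ parity-cp≡H₀ 3 1 4 B₀ N (s≤s z≤n) (s≤s z≤n) (s≤s z≤n) N≤B₀ ⟩
  Copartitions₃₁₄.H N 0 N
    ≡⟨ Copartitions₃₁₄.H0≈pentagonal N N (s≤s N≤B₀) ⟩
  (pentagonalSeries 1 B₀ · pentagonalSeries 4 N) N
    ≡⟨ pentagonal-product-vanishes B₀ N k r r∈ ⟩
  false ∎)
  where
  open ≡-Reasoning
  N : ℕ
  N = 49 * k + r
  B₀ : ℕ
  B₀ = (N + N) + (N + N)
  N≤B₀ : N ≤ B₀
  N≤B₀ = ≤-trans (m≤m+n N N) (m≤m+n (N + N) (N + N))
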